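{- For all $n\ge 1$, $|\{\pi\in\mathcal{S}_n:{\sf a}_3(\pi)=1\}|=\binom{2n-1}{n-3}$ (interpreted as $0$ when $n<3$).
   Context: ${\sf a}_3(\pi)$, for $\pi\in\mathcal{S}_n$, is the number of distinct pairs $(i,j)$ with $1\le i<j\le n$ such that there exists $k<i$ with $\pi_k<\pi_j<\pi_i$ (i.e. $i,j$ are the final two terms of an occurrence of the pattern $132$ in $\pi$). -}

module Defs where

open import Data.Nat using (ℕ; zero; suc; _+_; _*_; _∸_)
open import Data.Nat.Combinatorics using (_C_)
open import Data.Fin using (Fin; _<_; _<?_)
open import Data.Fin.Properties using (_≟_; all?; any?)
open import Data.Vec using (Vec; []; _∷_; lookup)
open import Data.List using (List; []; _∷_; map; concatMap; filter; length)
open import Data.List.Base using (allFin)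
open import Data.Product using (_×_; ∃-syntax)
open import Relation.Nullary using (Dec; yes; no; ¬_)
open import Relation.Nullary.Decidable using (_×-dec_; _→-dec_)
open import Relation.Binary.PropositionalEquality using (_≡_)
import Data.Nat as ℕ

-- A permutation in S_n is a word π = π_0 … π_{n-1} over Fin n (0-based
-- indices/values) whose entries are pairwise distinct.
IsPerm : ∀ {n} → Vec (Fin n) n → Set
IsPerm {n} π = (i j : Fin n) → lookup π i ≡ lookup π j → i ≡ j

isPerm? : ∀ {n} (π : Vec (Fin n) n) → Dec (IsPerm π)
isPerm? π = all? λ i → all? λ j → (lookup π i ≟ lookup π j) →-dec (i ≟ j)

Ends132 : ∀ {n} → Vec (Fin n) n → Fin n → Fin n → Set
Ends132 {n} π i j =
  i < j × ∃[ k ] (k < i × lookup π k < lookup π j × lookup π j < lookup π i)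

ends132? : ∀ {n} (π : Vec (Fin n) n) (i j : Fin n) → Dec (Ends132 π i j)
ends132? π i j =
  (i <? j) ×-dec any? λ k →
    (k <? i) ×-dec (lookup π k <? lookup π j) ×-dec (lookup π j <? lookup π i)

pairs : ∀ n → List (Fin n × Fin n)
pairs n = concatMap (λ i → map (λ j → (i Data.Product., j)) (allFin n)) (allFin n)

a3 : ∀ {n} → Vec (Fin n) n → ℕ
a3 {n} π = length (filter (λ p → ends132? π (Data.Product.proj₁ p) (Data.Product.proj₂ p)) (pairs n))

words : ∀ n m → List (Vec (Fin n) m)
words n zero = [] ∷ []
words n (suc m) = concatMap (λ x → map (x ∷_) (words n m)) (allFin n)

countA3one : ℕ → ℕ
countA3one n = length (filter (λ π → isPerm? π ×-dec (a3 π ℕ.≟ 1)) (words n n))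

binomA : ℕ → ℕ
binomA (suc (suc (suc m))) = (2 * (m + 3) ∸ 1) C m
binomA _ = 0

-- Write π ∈ S_{n+1} as its first letter x followed by some σ ∈ S_n relabelled around x.
-- Then a₃(π) = a₃(σ) + N, where N counts the pairs that end a 132 only thanks to x:
-- N = 0 iff σ₁ ≤ x, and otherwise N = 1 iff σ₁ = x + 1 and σ₂ < σ₁.  Refined by the first
-- letter, the numbers a, b, d of permutations with a₃ = 0, with a₃ = 1, and with a₃ = 0 and
-- a descent at the start therefore satisfy triangular recurrences.  In them a is the ballot
-- triangle, b_{q+2}(v) + a_{q+2}(v) = (q + 1) a_{q+1}(v) + C(q + v, v − 3), and the last row
-- of b sums to C(2n − 1, n − 3).
module Submission where

open import Data.Empty using (⊥; ⊥-elim)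
open import Data.Fin as Fin using (Fin; zero; suc; toℕ; punchIn; punchOut; fromℕ<)
open import Data.Fin.Properties as Finₚ
  using (all?; any?; pigeonhole; punchIn-injective; punchInᵢ≢i; punchOut-injective; toℕ<n; toℕ-fromℕ<; toℕ-injective)
open import Data.List using (List; []; _∷_; _++_; filter; length; concatMap; allFin; tabulate)
import Data.List as List using (map)
open import Data.List.Properties using (map-++; map-∘)
open import Data.Nat as ℕ using (ℕ; zero; suc; _+_; _*_; _∸_; _≤_; _<_; z≤n; s≤s; s≤s⁻¹)
open import Data.Nat.Combinatorics using (_C_; nCk+nC[k+1]≡[n+1]C[k+1]; nCk≡nC[n∸k])
open import Data.Nat.Combinatorics.Specification using (k>n⇒nCk≡0)
import Data.Nat.ListAction as Listℕ
open import Data.Nat.ListAction.Properties using (sum-++)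
open import Data.Nat.Properties
open import Data.Product using (_×_; _,_; proj₁; proj₂; ∃-syntax)
open import Data.Sum using (_⊎_; inj₁; inj₂)
open import Data.Vec using (Vec; []; _∷_; lookup; map)
open import Data.Vec.Properties using (lookup-map)
open import Function using (_∘_)
open import Relation.Binary.Definitions using (tri<; tri≈; tri>)
open import Relation.Binary.PropositionalEquality
open import Relation.Nullary using (Dec; yes; no; ¬_)
open import Relation.Nullary.Decidable using (_×-dec_; _→-dec_; ¬?)
open import Relation.Unary using (Decidable)
open import Algebra.Properties.CommutativeSemigroup +-commutativeSemigroup using (interchange; xy∙z≈xz∙y; xy∙z≈zx∙y)
open import Algebra.Properties.Semiring.Sum +-*-semiring
  using (sum; sum-syntax; sum-cong-≗; sum-replicate-zero; sum-remove; ∑-distrib-+; *-distribˡ-sum)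
open import Defs
open ≡-Reasoning

ind : {P : Set} → Dec P → ℕ
ind (yes _) = 1
ind (no _)  = 0

module _ {P Q : Set} where

  ind-⇔ : (P → Q) → (Q → P) → (P? : Dec P) (Q? : Dec Q) → ind P? ≡ ind Q?
  ind-⇔ _ _ (yes _) (yes _) = refl
  ind-⇔ f _ (yes p) (no ¬q) = ⊥-elim (¬q (f p))
  ind-⇔ _ g (no ¬p) (yes q) = ⊥-elim (¬p (g q))
  ind-⇔ _ _ (no _)  (no _)  = refl

  ind-× : (P? : Dec P) (Q? : Dec Q) → ind (P? ×-dec Q?) ≡ ind P? * ind Q?
  ind-× (yes _) (yes _) = refl
  ind-× (yes _) (no _)  = refl
  ind-× (no _)  _       = refl

  ind-⊎ : ∀ {R : Set} → (P → Q ⊎ R) → (Q ⊎ R → P) → (Q → ¬ R) →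
          (P? : Dec P) (Q? : Dec Q) (R? : Dec R) → ind P? ≡ ind Q? + ind R?
  ind-⊎ _ _ disj (yes _) (yes q) (yes r) = ⊥-elim (disj q r)
  ind-⊎ _ _ _    (yes _) (yes _) (no _)  = refl
  ind-⊎ _ _ _    (yes _) (no _)  (yes _) = refl
  ind-⊎ f _ _    (yes p) (no ¬q) (no ¬r) with f p
  ... | inj₁ q = ⊥-elim (¬q q)
  ... | inj₂ r = ⊥-elim (¬r r)
  ind-⊎ _ g _    (no ¬p) (yes q) _       = ⊥-elim (¬p (g (inj₁ q)))
  ind-⊎ _ g _    (no ¬p) (no _)  (yes r) = ⊥-elim (¬p (g (inj₂ r)))
  ind-⊎ _ _ _    (no _)  (no _)  (no _)  = refl

ind-yes : {P : Set} → P → (P? : Dec P) → ind P? ≡ 1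
ind-yes _ (yes _)  = refl
ind-yes p (no ¬p) = ⊥-elim (¬p p)

ind-no : {P : Set} → ¬ P → (P? : Dec P) → ind P? ≡ 0
ind-no ¬p (yes p) = ⊥-elim (¬p p)
ind-no _  (no _)  = refl

sum-zero : ∀ {n} (f : Fin n → ℕ) → (∀ i → f i ≡ 0) → sum f ≡ 0
sum-zero {n} f f≗0 = trans (sum-cong-≗ f≗0) (sum-replicate-zero n)

≤-sum : ∀ {n} (f : Fin n → ℕ) i → f i ≤ sum f
≤-sum f zero    = m≤m+n _ _
≤-sum f (suc i) = ≤-trans (≤-sum (f ∘ suc) i) (m≤n+m _ _)

+-≤-sum : ∀ {n} (f : Fin n → ℕ) {i j} → i ≢ j → f i + f j ≤ sum f
+-≤-sum f {zero}  {zero}  i≢j = ⊥-elim (i≢j refl)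
+-≤-sum f {zero}  {suc j} _   = +-monoʳ-≤ (f zero) (≤-sum (f ∘ suc) j)
+-≤-sum f {suc i} {zero}  _   =
  subst (_≤ sum f) (+-comm (f zero) (f (suc i))) (+-monoʳ-≤ (f zero) (≤-sum (f ∘ suc) i))
+-≤-sum f {suc i} {suc j} i≢j = ≤-trans (+-≤-sum (f ∘ suc) (i≢j ∘ cong suc)) (m≤n+m _ _)

sum-single : ∀ {n} (f : Fin n → ℕ) i₀ → (∀ i → i ≢ i₀ → f i ≡ 0) → sum f ≡ f i₀
sum-single {suc n} f i₀ f≡0 = begin
  sum f                              ≡⟨ sum-remove {i = i₀} f ⟩
  f i₀ + ∑[ i < n ] f (punchIn i₀ i) ≡⟨ cong (f i₀ +_) (sum-zero {n} _ (λ i → f≡0 _ (punchInᵢ≢i i₀ i))) ⟩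
  f i₀ + 0                           ≡⟨ +-identityʳ (f i₀) ⟩
  f i₀                               ∎

≤-sum² : ∀ {m n} (f : Fin m → Fin n → ℕ) i j → f i j ≤ ∑[ a < m ] ∑[ b < n ] f a b
≤-sum² f i j = ≤-trans (≤-sum (f i) j) (≤-sum (λ a → sum (f a)) i)

+-≤-sum² : ∀ {m n} (f : Fin m → Fin n → ℕ) {i j i′ j′} → (i , j) ≢ (i′ , j′) →
           f i j + f i′ j′ ≤ ∑[ a < m ] ∑[ b < n ] f a b
+-≤-sum² f {i} {j} {i′} {j′} ij≢i′j′ with i Finₚ.≟ i′
... | yes refl = ≤-trans (+-≤-sum (f i) (λ j≡j′ → ij≢i′j′ (cong (i ,_) j≡j′))) (≤-sum (λ a → sum (f a)) i)
... | no i≢i′  = ≤-trans (+-mono-≤ (≤-sum (f i) j) (≤-sum (f i′) j′)) (+-≤-sum (λ a → sum (f a)) i≢i′)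

sum-select : ∀ {n} (H : ℕ → ℕ) {v} → v < n → ∑[ x < n ] (H (toℕ x) * ind (toℕ x ℕ.≟ v)) ≡ H v
sum-select {suc n} H {zero} _ = begin
  H 0 * 1 + ∑[ x < n ] (H (suc (toℕ x)) * 0)
    ≡⟨ cong₂ _+_ (*-identityʳ (H 0)) (sum-zero {n} _ (λ x → *-zeroʳ (H (suc (toℕ x))))) ⟩
  H 0 + 0
    ≡⟨ +-identityʳ (H 0) ⟩
  H 0 ∎
sum-select {suc n} H {suc v} (s≤s v<n) = begin
  H 0 * 0 + ∑[ x < n ] (H (suc (toℕ x)) * ind (suc (toℕ x) ℕ.≟ suc v))
    ≡⟨ cong (H 0 * 0 +_) (sum-cong-≗ {n} λ x → cong (H (suc (toℕ x)) *_)
         (ind-⇔ suc-injective (cong suc) (suc (toℕ x) ℕ.≟ suc v) (toℕ x ℕ.≟ v))) ⟩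
  H 0 * 0 + ∑[ x < n ] (H (suc (toℕ x)) * ind (toℕ x ℕ.≟ v))
    ≡⟨ cong₂ _+_ (*-zeroʳ (H 0)) (sum-select (H ∘ suc) v<n) ⟩
  H (suc v) ∎

sum≤ : ℕ → (ℕ → ℕ) → ℕ
sum≤ zero    g = g 0
sum≤ (suc v) g = sum≤ v g + g (suc v)

sum≤-cong : ∀ v {f g : ℕ → ℕ} → (∀ s → s ≤ v → f s ≡ g s) → sum≤ v f ≡ sum≤ v g
sum≤-cong zero    f≗g = f≗g 0 z≤n
sum≤-cong (suc v) f≗g = cong₂ _+_ (sum≤-cong v (λ s s≤v → f≗g s (m≤n⇒m≤1+n s≤v))) (f≗g (suc v) ≤-refl)

sum≤-distrib-+ : ∀ v (f g : ℕ → ℕ) → sum≤ v (λ s → f s + g s) ≡ sum≤ v f + sum≤ v g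
sum≤-distrib-+ zero    f g = refl
sum≤-distrib-+ (suc v) f g = begin
  sum≤ v (λ s → f s + g s) + (f (suc v) + g (suc v))
    ≡⟨ cong (_+ (f (suc v) + g (suc v))) (sum≤-distrib-+ v f g) ⟩
  (sum≤ v f + sum≤ v g) + (f (suc v) + g (suc v))
    ≡⟨ interchange (sum≤ v f) (sum≤ v g) (f (suc v)) (g (suc v)) ⟩
  (sum≤ v f + f (suc v)) + (sum≤ v g + g (suc v)) ∎

*-distribˡ-sum≤ : ∀ v c (f : ℕ → ℕ) → c * sum≤ v f ≡ sum≤ v (λ s → c * f s)
*-distribˡ-sum≤ zero    c f = refl
*-distribˡ-sum≤ (suc v) c f =
  trans (*-distribˡ-+ c (sum≤ v f) (f (suc v))) (cong (_+ c * f (suc v)) (*-distribˡ-sum≤ v c f))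

ind-≤-sum≤ : ∀ h v → ind (h ℕ.≤? v) ≡ sum≤ v (λ s → ind (h ℕ.≟ s))
ind-≤-sum≤ h zero    = ind-⇔ n≤0⇒n≡0 (λ { refl → z≤n }) (h ℕ.≤? 0) (h ℕ.≟ 0)
ind-≤-sum≤ h (suc v) = begin
  ind (h ℕ.≤? suc v)
    ≡⟨ ind-⊎ split join (λ h≤v h≡1+v → <-irrefl h≡1+v (s≤s h≤v)) (h ℕ.≤? suc v) (h ℕ.≤? v) (h ℕ.≟ suc v) ⟩
  ind (h ℕ.≤? v) + ind (h ℕ.≟ suc v)
    ≡⟨ cong (_+ ind (h ℕ.≟ suc v)) (ind-≤-sum≤ h v) ⟩
  sum≤ (suc v) (λ s → ind (h ℕ.≟ s)) ∎
  where
  split : h ≤ suc v → h ≤ v ⊎ h ≡ suc v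
  split h≤1+v with m≤n⇒m<n∨m≡n h≤1+v
  ... | inj₁ h<1+v = inj₁ (s≤s⁻¹ h<1+v)
  ... | inj₂ h≡1+v = inj₂ h≡1+v
  join : h ≤ v ⊎ h ≡ suc v → h ≤ suc v
  join (inj₁ h≤v)  = m≤n⇒m≤1+n h≤v
  join (inj₂ refl) = ≤-refl

length-filter : ∀ {A : Set} {P : A → Set} (P? : Decidable P) (xs : List A) →
                length (filter P? xs) ≡ Listℕ.sum (List.map (ind ∘ P?) xs)
length-filter P? []       = refl
length-filter P? (x ∷ xs) with P? x
... | yes _ = cong suc (length-filter P? xs)
... | no _  = length-filter P? xs

sum-map-concatMap : ∀ {A B : Set} (g : A → List B) (h : B → ℕ) (xs : List A) →
                    Listℕ.sum (List.map h (concatMap g xs)) ≡ Listℕ.sum (List.map (Listℕ.sum ∘ List.map h ∘ g) xs)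
sum-map-concatMap g h []       = refl
sum-map-concatMap g h (x ∷ xs) = begin
  Listℕ.sum (List.map h (g x ++ concatMap g xs))
    ≡⟨ cong Listℕ.sum (map-++ h (g x) (concatMap g xs)) ⟩
  Listℕ.sum (List.map h (g x) ++ List.map h (concatMap g xs))
    ≡⟨ sum-++ (List.map h (g x)) _ ⟩
  Listℕ.sum (List.map h (g x)) + Listℕ.sum (List.map h (concatMap g xs))
    ≡⟨ cong (Listℕ.sum (List.map h (g x)) +_) (sum-map-concatMap g h xs) ⟩
  Listℕ.sum (List.map (Listℕ.sum ∘ List.map h ∘ g) (x ∷ xs)) ∎

sum-map-tabulate : ∀ {A : Set} {n} (f : Fin n → A) (h : A → ℕ) →
                   Listℕ.sum (List.map h (tabulate f)) ≡ sum (h ∘ f)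
sum-map-tabulate {n = zero}  f h = refl
sum-map-tabulate {n = suc n} f h = cong (h (f zero) +_) (sum-map-tabulate (f ∘ suc) h)

-- Pascal's rule holds by definition here, unlike for _C_.
binom : ℕ → ℕ → ℕ
binom _       zero    = 1
binom zero    (suc k) = 0
binom (suc n) (suc k) = binom n k + binom n (suc k)

binom≡C : ∀ n k → binom n k ≡ n C k
binom≡C n       zero    = refl
binom≡C zero    (suc k) = sym (k>n⇒nCk≡0 {0} {suc k} (s≤s z≤n))
binom≡C (suc n) (suc k) = trans (cong₂ _+_ (binom≡C n k) (binom≡C n (suc k))) (nCk+nC[k+1]≡[n+1]C[k+1] n k)

binom-sym : ∀ k j → binom (k + j) k ≡ binom (k + j) j
binom-sym k j = begin
  binom (k + j) k          ≡⟨ binom≡C (k + j) k ⟩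
  (k + j) C k              ≡⟨ nCk≡nC[n∸k] (m≤m+n k j) ⟩
  (k + j) C (k + j ∸ k)    ≡⟨ cong ((k + j) C_) (m+n∸m≡n k j) ⟩
  (k + j) C j              ≡⟨ binom≡C (k + j) j ⟨
  binom (k + j) j          ∎

binom-1 : ∀ n → binom n 1 ≡ n
binom-1 zero    = refl
binom-1 (suc n) = cong suc (binom-1 n)

binom-absorption : ∀ n k → suc k * binom (suc n) (suc k) ≡ suc n * binom n k
binom-absorption zero    zero    = refl
binom-absorption zero    (suc k) = *-zeroʳ (suc (suc k))
binom-absorption (suc n) zero    = begin
  1 * binom (suc (suc n)) 1  ≡⟨ *-identityˡ _ ⟩
  binom (suc (suc n)) 1      ≡⟨ binom-1 (suc (suc n)) ⟩
  suc (suc n)                ≡⟨ *-identityʳ (suc (suc n)) ⟨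
  suc (suc n) * 1            ∎
binom-absorption (suc n) (suc k) = begin
  suc (suc k) * (binom (suc n) (suc k) + binom (suc n) (suc (suc k)))
    ≡⟨ *-distribˡ-+ (suc (suc k)) (binom (suc n) (suc k)) _ ⟩
  (binom (suc n) (suc k) + suc k * binom (suc n) (suc k)) + suc (suc k) * binom (suc n) (suc (suc k))
    ≡⟨ cong₂ (λ x y → (binom (suc n) (suc k) + x) + y) (binom-absorption n k) (binom-absorption n (suc k)) ⟩
  (binom (suc n) (suc k) + suc n * binom n k) + suc n * binom n (suc k)
    ≡⟨ +-assoc (binom (suc n) (suc k)) _ _ ⟩
  binom (suc n) (suc k) + (suc n * binom n k + suc n * binom n (suc k))
    ≡⟨ cong (binom (suc n) (suc k) +_) (*-distribˡ-+ (suc n) (binom n k) _) ⟨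
  suc (suc n) * binom (suc n) (suc k) ∎

binom-central-ratio : ∀ r → suc r * binom (suc r + suc r) (suc r) ≡ suc (suc r) * binom (suc r + suc r) r
binom-central-ratio r = begin
  suc r * binom (suc r + suc r) (suc r)      ≡⟨ cong (λ n → suc r * binom (suc n) (suc r)) (+-suc r r) ⟩
  suc r * binom (suc (suc (r + r))) (suc r)  ≡⟨ binom-absorption (suc (r + r)) r ⟩
  suc (suc (r + r)) * binom (suc (r + r)) r  ≡⟨ cong (λ n → suc n * binom n r) (+-suc r r) ⟨
  suc (r + suc r) * binom (r + suc r) r      ≡⟨ absorption-sym r (suc r) ⟨
  suc (suc r) * binom (suc r + suc r) r      ∎
  where
  absorption-sym : ∀ k j → suc j * binom (suc (k + j)) k ≡ suc (k + j) * binom (k + j) k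
  absorption-sym k j = begin
    suc j * binom (suc (k + j)) k        ≡⟨ cong (λ n → suc j * binom n k) (+-suc k j) ⟨
    suc j * binom (k + suc j) k          ≡⟨ cong (suc j *_) (binom-sym k (suc j)) ⟩
    suc j * binom (k + suc j) (suc j)    ≡⟨ cong (λ n → suc j * binom n (suc j)) (+-suc k j) ⟩
    suc j * binom (suc (k + j)) (suc j)  ≡⟨ binom-absorption (k + j) j ⟩
    suc (k + j) * binom (k + j) j        ≡⟨ cong (suc (k + j) *_) (binom-sym k j) ⟨
    suc (k + j) * binom (k + j) k        ∎

-- binom-shift d n k = C(n, k - d), read as 0 when k < d
binom-shift : ℕ → ℕ → ℕ → ℕ
binom-shift zero    n k       = binom n k
binom-shift (suc d) n zero    = 0
binom-shift (suc d) n (suc k) = binom-shift d n k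

binom-shift-pascal : ∀ d n k →
                     binom-shift d (suc n) (suc k) ≡ binom-shift d n k + binom-shift d n (suc k)
binom-shift-pascal zero          n k       = refl
binom-shift-pascal (suc zero)    n zero    = refl
binom-shift-pascal (suc (suc d)) n zero    = refl
binom-shift-pascal (suc d)       n (suc k) = binom-shift-pascal d n k

binom-shift-hockey : ∀ d c v → sum≤ v (λ s → binom-shift (suc d) (c + s) s) ≡ binom-shift (suc d) (suc c + v) v
binom-shift-hockey d c zero    = refl
binom-shift-hockey d c (suc v) = begin
  sum≤ v (λ s → C (c + s) s) + C (c + suc v) (suc v)
    ≡⟨ cong₂ _+_ (binom-shift-hockey d c v) (cong (λ n → C n (suc v)) (+-suc c v)) ⟩
  C (suc c + v) v + C (suc c + v) (suc v)
    ≡⟨ binom-shift-pascal (suc d) (suc c + v) v ⟨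
  C (suc (suc c + v)) (suc v)
    ≡⟨ cong (λ n → C n (suc v)) (+-suc (suc c) v) ⟨
  C (suc c + suc v) (suc v) ∎
  where C = binom-shift (suc d)

module Recurrences
  (a b d : ℕ → ℕ → ℕ)
  (a-base : a 1 0 ≡ 1)
  (a-out  : ∀ p v → p < v → a (suc p) v ≡ 0)
  (a-step : ∀ p v → v ≤ suc p → a (suc (suc p)) v ≡ sum≤ v (a (suc p)))
  (b-base : ∀ v → b 1 v ≡ 0)
  (b-out  : ∀ p v → p < v → b (suc p) v ≡ 0)
  (b-step : ∀ p v → v ≤ suc p → b (suc (suc p)) v ≡ sum≤ v (b (suc p)) + d (suc p) v)
  (d-base : ∀ v → d 1 v ≡ 0)
  (d-step : ∀ p v → v ≤ p → d (suc (suc p)) v ≡ sum≤ v (a (suc p)))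
  (d-out  : ∀ p v → p < v → d (suc (suc p)) v ≡ 0)
  where

  private
    C₁ C₃ : ℕ → ℕ → ℕ
    C₁ = binom-shift 1
    C₃ = binom-shift 3

  d-out′ : ∀ p v → p ≤ v → d (suc p) v ≡ 0
  d-out′ zero    v _     = d-base v
  d-out′ (suc p) v 1+p≤v = d-out p v 1+p≤v

  a-step-suc : ∀ p v → v ≤ p → a (suc (suc p)) (suc v) ≡ a (suc (suc p)) v + a (suc p) (suc v)
  a-step-suc p v v≤p = begin
    a (suc (suc p)) (suc v)                 ≡⟨ a-step p (suc v) (s≤s v≤p) ⟩
    sum≤ v (a (suc p)) + a (suc p) (suc v)  ≡⟨ cong (_+ a (suc p) (suc v)) (a-step p v (m≤n⇒m≤1+n v≤p)) ⟨
    a (suc (suc p)) v + a (suc p) (suc v)   ∎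

  a-flat : ∀ q → a (suc (suc q)) (suc q) ≡ a (suc (suc q)) q
  a-flat q = begin
    a (suc (suc q)) (suc q)                ≡⟨ a-step-suc q q ≤-refl ⟩
    a (suc (suc q)) q + a (suc q) (suc q)  ≡⟨ cong (a (suc (suc q)) q +_) (a-out q (suc q) ≤-refl) ⟩
    a (suc (suc q)) q + 0                  ≡⟨ +-identityʳ _ ⟩
    a (suc (suc q)) q                      ∎

  b-diagonal : ∀ q → b (suc (suc q)) q ≡ sum≤ q (b (suc q))
  b-diagonal q = begin
    b (suc (suc q)) q                     ≡⟨ b-step q q (n≤1+n q) ⟩
    sum≤ q (b (suc q)) + d (suc q) q      ≡⟨ cong (sum≤ q (b (suc q)) +_) (d-out′ q q ≤-refl) ⟩
    sum≤ q (b (suc q)) + 0                ≡⟨ +-identityʳ _ ⟩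
    sum≤ q (b (suc q))                    ∎

  b-flat : ∀ q → b (suc (suc q)) (suc q) ≡ b (suc (suc q)) q
  b-flat q = begin
    b (suc (suc q)) (suc q)
      ≡⟨ b-step q (suc q) ≤-refl ⟩
    (sum≤ q (b (suc q)) + b (suc q) (suc q)) + d (suc q) (suc q)
      ≡⟨ cong₂ (λ x y → (sum≤ q (b (suc q)) + x) + y) (b-out q (suc q) ≤-refl) (d-out′ q (suc q) (n≤1+n q)) ⟩
    (sum≤ q (b (suc q)) + 0) + 0
      ≡⟨ trans (+-identityʳ _) (+-identityʳ _) ⟩
    sum≤ q (b (suc q))
      ≡⟨ b-diagonal q ⟨
    b (suc (suc q)) q ∎

  a-ballot : ∀ p v → v ≤ p → a (suc p) v + C₁ (p + v) v ≡ binom (p + v) v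
  a-ballot zero    zero    _         = trans (+-identityʳ (a 1 0)) a-base
  a-ballot (suc p) zero    _         = trans (cong (_+ 0) (a-step p 0 z≤n)) (a-ballot p 0 z≤n)
  a-ballot (suc p) (suc v) (s≤s v≤p) = begin
    a (suc (suc p)) (suc v) + binom (suc p + suc v) v
      ≡⟨ cong₂ _+_ (a-step-suc p v v≤p) (cong (λ n → binom n v) (+-suc (suc p) v)) ⟩
    (a (suc (suc p)) v + a (suc p) (suc v)) + binom (suc N) v
      ≡⟨ cong ((a (suc (suc p)) v + a (suc p) (suc v)) +_) (binom-shift-pascal 1 N v) ⟩
    (a (suc (suc p)) v + a (suc p) (suc v)) + (C₁ N v + binom N v)
      ≡⟨ interchange (a (suc (suc p)) v) (a (suc p) (suc v)) (C₁ N v) (binom N v) ⟩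
    (a (suc (suc p)) v + C₁ N v) + (a (suc p) (suc v) + binom N v)
      ≡⟨ cong₂ _+_ (a-ballot (suc p) v (m≤n⇒m≤1+n v≤p)) (previous-row (m≤n⇒m<n∨m≡n v≤p)) ⟩
    binom N v + binom N (suc v)
      ≡⟨ cong (λ n → binom n (suc v)) (+-suc (suc p) v) ⟨
    binom (suc p + suc v) (suc v) ∎
    where
    N = suc p + v
    previous-row : v < p ⊎ v ≡ p → a (suc p) (suc v) + binom N v ≡ binom N (suc v)
    previous-row (inj₁ v<p) = begin
      a (suc p) (suc v) + binom N v              ≡⟨ cong (λ n → a (suc p) (suc v) + binom n v) (+-suc p v) ⟨
      a (suc p) (suc v) + binom (p + suc v) v    ≡⟨ a-ballot p (suc v) v<p ⟩
      binom (p + suc v) (suc v)                  ≡⟨ cong (λ n → binom n (suc v)) (+-suc p v) ⟩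
      binom N (suc v)                            ∎
    previous-row (inj₂ refl) = begin
      a (suc v) (suc v) + binom N v  ≡⟨ cong (_+ binom N v) (a-out v (suc v) ≤-refl) ⟩
      binom (suc v + v) v            ≡⟨ binom-sym (suc v) v ⟨
      binom (suc v + v) (suc v)      ∎

  a-diagonal : ∀ q → suc q * a (suc q) q ≡ binom (q + q) q
  a-diagonal zero    = trans (*-identityˡ (a 1 0)) a-base
  a-diagonal (suc r) = +-cancelʳ-≡ (suc q * C₁ N q) (suc q * a (suc q) q) (binom N q) (begin
    suc q * a (suc q) q + suc q * C₁ N q   ≡⟨ *-distribˡ-+ (suc q) (a (suc q) q) (C₁ N q) ⟨
    suc q * (a (suc q) q + C₁ N q)         ≡⟨ cong (suc q *_) (a-ballot q q ≤-refl) ⟩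
    binom N q + q * binom N q              ≡⟨ cong (binom N q +_) (binom-central-ratio r) ⟩
    binom N q + suc q * C₁ N q             ∎)
    where
    q = suc r
    N = q + q

  a-subdiagonal : ∀ q → a (suc (suc q)) q + C₃ (q + q) (suc q) ≡ binom (q + q) q
  a-subdiagonal q = +-cancelʳ-≡ (C₁ N q) (A + C₃ N (suc q)) (binom N q) (begin
    (A + C₃ N (suc q)) + C₁ N q  ≡⟨ +-assoc A (C₃ N (suc q)) (C₁ N q) ⟩
    A + (C₃ N (suc q) + C₁ N q)  ≡⟨ cong (A +_) (binom-shift-pascal 2 N q) ⟨
    A + C₁ (suc N) q             ≡⟨ a-ballot (suc q) q (n≤1+n q) ⟩
    binom (suc N) q              ≡⟨ binom-shift-pascal 1 N q ⟩
    C₁ N q + binom N q           ≡⟨ +-comm (C₁ N q) (binom N q) ⟩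
    binom N q + C₁ N q           ∎)
    where
    N = q + q
    A = a (suc (suc q)) q

  a-diagonal-step : ∀ q → suc q * a (suc q) q + C₃ (q + q) q ≡ a (suc (suc q)) q + C₃ (suc (q + q)) (suc q)
  a-diagonal-step q = begin
    suc q * a (suc q) q + C₃ N q    ≡⟨ cong (_+ C₃ N q) (trans (a-diagonal q) (sym (a-subdiagonal q))) ⟩
    (A + C₃ N (suc q)) + C₃ N q     ≡⟨ +-assoc A (C₃ N (suc q)) (C₃ N q) ⟩
    A + (C₃ N (suc q) + C₃ N q)     ≡⟨ cong (A +_) (+-comm (C₃ N (suc q)) (C₃ N q)) ⟩
    A + (C₃ N q + C₃ N (suc q))     ≡⟨ cong (A +_) (binom-shift-pascal 3 N q) ⟨
    A + C₃ (suc N) (suc q)          ∎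
    where
    N = q + q
    A = a (suc (suc q)) q

  -- b alone has no simple closed form, but b + a does
  B+A : ℕ → ℕ → Set
  B+A q v = b (suc (suc q)) v + a (suc (suc q)) v ≡ suc q * a (suc q) v + C₃ (q + v) v

  b+a-step : ∀ q v → v ≤ suc q →
             b (suc (suc (suc q))) v + a (suc (suc (suc q))) v
               ≡ sum≤ v (λ s → b (suc (suc q)) s + a (suc (suc q)) s) + d (suc (suc q)) v
  b+a-step q v v≤1+q = begin
    b (suc (suc (suc q))) v + a (suc (suc (suc q))) v
      ≡⟨ cong₂ _+_ (b-step (suc q) v (m≤n⇒m≤1+n v≤1+q)) (a-step (suc q) v (m≤n⇒m≤1+n v≤1+q)) ⟩
    (sum≤ v B + D) + sum≤ v A  ≡⟨ xy∙z≈xz∙y (sum≤ v B) D (sum≤ v A) ⟩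
    (sum≤ v B + sum≤ v A) + D  ≡⟨ cong (_+ D) (sum≤-distrib-+ v B A) ⟨
    sum≤ v (λ s → B s + A s) + D ∎
    where
    A = a (suc (suc q))
    B = b (suc (suc q))
    D = d (suc (suc q)) v

  b+a-sum : ∀ q → (∀ v → v ≤ q → B+A q v) → ∀ v → v ≤ q →
            sum≤ v (λ s → b (suc (suc q)) s + a (suc (suc q)) s) ≡ suc q * a (suc (suc q)) v + C₃ (suc q + v) v
  b+a-sum q ih v v≤q = begin
    sum≤ v (λ s → b (suc (suc q)) s + a (suc (suc q)) s)
      ≡⟨ sum≤-cong v (λ s s≤v → ih s (≤-trans s≤v v≤q)) ⟩
    sum≤ v (λ s → suc q * a (suc q) s + C₃ (q + s) s)
      ≡⟨ sum≤-distrib-+ v (λ s → suc q * a (suc q) s) (λ s → C₃ (q + s) s) ⟩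
    sum≤ v (λ s → suc q * a (suc q) s) + sum≤ v (λ s → C₃ (q + s) s)
      ≡⟨ cong₂ _+_ (sym (*-distribˡ-sum≤ v (suc q) (a (suc q)))) (binom-shift-hockey 2 q v) ⟩
    suc q * sum≤ v (a (suc q)) + C₃ (suc q + v) v
      ≡⟨ cong (λ x → suc q * x + C₃ (suc q + v) v) (a-step q v (m≤n⇒m≤1+n v≤q)) ⟨
    suc q * a (suc (suc q)) v + C₃ (suc q + v) v ∎

  b+a-below : ∀ q → (∀ v → v ≤ q → B+A q v) → ∀ v → v ≤ q → B+A (suc q) v
  b+a-below q ih v v≤q = begin
    b (suc (suc (suc q))) v + a (suc (suc (suc q))) v
      ≡⟨ b+a-step q v (m≤n⇒m≤1+n v≤q) ⟩
    sum≤ v (λ s → b (suc (suc q)) s + a (suc (suc q)) s) + d (suc (suc q)) v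
      ≡⟨ cong₂ _+_ (b+a-sum q ih v v≤q) (trans (d-step q v v≤q) (sym (a-step q v (m≤n⇒m≤1+n v≤q)))) ⟩
    (suc q * A + G) + A   ≡⟨ xy∙z≈zx∙y (suc q * A) G A ⟩
    suc (suc q) * A + G   ∎
    where
    A = a (suc (suc q)) v
    G = C₃ (suc q + v) v

  b+a-diagonal : ∀ q → (∀ v → v ≤ q → B+A q v) → B+A (suc q) (suc q)
  b+a-diagonal q ih = begin
    b (suc (suc (suc q))) (suc q) + a (suc (suc (suc q))) (suc q)
      ≡⟨ b+a-step q (suc q) ≤-refl ⟩
    (sum≤ q (λ s → b (suc (suc q)) s + A s) + (b (suc (suc q)) (suc q) + A (suc q))) + d (suc (suc q)) (suc q)
      ≡⟨ cong₂ _+_ (cong₂ _+_ (b+a-sum q ih q ≤-refl) last-column) (d-out q (suc q) ≤-refl) ⟩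
    ((suc q * A q + C₃ S q) + (suc q * a (suc q) q + C₃ (q + q) q)) + 0
      ≡⟨ trans (+-identityʳ _) (cong ((suc q * A q + C₃ S q) +_) (a-diagonal-step q)) ⟩
    (suc q * A q + C₃ S q) + (A q + C₃ S (suc q))
      ≡⟨ interchange (suc q * A q) (C₃ S q) (A q) (C₃ S (suc q)) ⟩
    (suc q * A q + A q) + (C₃ S q + C₃ S (suc q))
      ≡⟨ cong₂ _+_ (+-comm (suc q * A q) (A q)) (sym (binom-shift-pascal 3 S q)) ⟩
    suc (suc q) * A q + C₃ (suc S) (suc q)
      ≡⟨ cong₂ (λ x n → suc (suc q) * x + C₃ (suc n) (suc q)) (a-flat q) (+-suc q q) ⟨
    suc (suc q) * A (suc q) + C₃ (suc q + suc q) (suc q) ∎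
    where
    A = a (suc (suc q))
    S = suc (q + q)
    last-column : b (suc (suc q)) (suc q) + A (suc q) ≡ suc q * a (suc q) q + C₃ (q + q) q
    last-column = trans (cong₂ _+_ (b-flat q) (a-flat q)) (ih q ≤-refl)

  b+a : ∀ q v → v ≤ q → B+A q v
  b+a zero    zero    z≤n = begin
    b 2 0 + a 2 0  ≡⟨ cong₂ _+_ (trans (b-step 0 0 z≤n) (cong₂ _+_ (b-base 0) (d-base 0))) (a-step 0 0 z≤n) ⟩
    a 1 0          ≡⟨ trans (+-identityʳ _) (+-identityʳ _) ⟨
    1 * a 1 0 + 0  ∎
  b+a (suc q) v v≤1+q with m≤n⇒m<n∨m≡n v≤1+q
  ... | inj₁ (s≤s v≤q) = b+a-below q (b+a q) v v≤q
  ... | inj₂ refl      = b+a-diagonal q (b+a q)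

  sum-b : ∀ p → sum≤ p (b (suc p)) ≡ C₃ (suc (p + p)) (suc p)
  sum-b p = +-cancelʳ-≡ A (sum≤ p (b (suc p))) (C₃ (suc (p + p)) (suc p)) (begin
    sum≤ p (b (suc p)) + A                ≡⟨ cong (_+ A) (b-diagonal p) ⟨
    b (suc (suc p)) p + A                 ≡⟨ b+a p p ≤-refl ⟩
    suc p * a (suc p) p + C₃ (p + p) p    ≡⟨ a-diagonal-step p ⟩
    A + C₃ (suc (p + p)) (suc p)          ≡⟨ +-comm A _ ⟩
    C₃ (suc (p + p)) (suc p) + A          ∎)
    where A = a (suc (suc p)) p

sumWords : ∀ k m → (Vec (Fin k) m → ℕ) → ℕ
sumWords k zero    f = f []
sumWords k (suc m) f = ∑[ x < k ] sumWords k m (λ w → f (x ∷ w))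

module _ {k : ℕ} where

  sumWords-cong : ∀ m {f g : Vec (Fin k) m → ℕ} → (∀ w → f w ≡ g w) → sumWords k m f ≡ sumWords k m g
  sumWords-cong zero    f≗g = f≗g []
  sumWords-cong (suc m) f≗g = sum-cong-≗ {k} (λ x → sumWords-cong m (λ w → f≗g (x ∷ w)))

  sumWords-distrib-+ : ∀ m (f g : Vec (Fin k) m → ℕ) →
                       sumWords k m (λ w → f w + g w) ≡ sumWords k m f + sumWords k m g
  sumWords-distrib-+ zero    f g = refl
  sumWords-distrib-+ (suc m) f g =
    trans (sum-cong-≗ {k} (λ x → sumWords-distrib-+ m (λ w → f (x ∷ w)) (λ w → g (x ∷ w))))
          (∑-distrib-+ (λ x → sumWords k m (λ w → f (x ∷ w))) (λ x → sumWords k m (λ w → g (x ∷ w))))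

  *-distribˡ-sumWords : ∀ m c (f : Vec (Fin k) m → ℕ) → c * sumWords k m f ≡ sumWords k m (λ w → c * f w)
  *-distribˡ-sumWords zero    c f = refl
  *-distribˡ-sumWords (suc m) c f =
    trans (*-distribˡ-sum c (λ x → sumWords k m (λ w → f (x ∷ w))))
          (sum-cong-≗ {k} (λ x → *-distribˡ-sumWords m c (λ w → f (x ∷ w))))

  sumWords-zero : ∀ m (f : Vec (Fin k) m → ℕ) → (∀ w → f w ≡ 0) → sumWords k m f ≡ 0
  sumWords-zero zero    f f≗0 = f≗0 []
  sumWords-zero (suc m) f f≗0 = sum-zero {k} _ (λ x → sumWords-zero m _ (λ w → f≗0 (x ∷ w)))

  sum-map-words : ∀ m (f : Vec (Fin k) m → ℕ) → Listℕ.sum (List.map f (words k m)) ≡ sumWords k m f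
  sum-map-words zero    f = +-identityʳ (f [])
  sum-map-words (suc m) f = begin
    Listℕ.sum (List.map f (concatMap (λ x → List.map (x ∷_) (words k m)) (allFin k)))
      ≡⟨ sum-map-concatMap (λ x → List.map (x ∷_) (words k m)) f (allFin k) ⟩
    Listℕ.sum (List.map (λ x → Listℕ.sum (List.map f (List.map (x ∷_) (words k m)))) (allFin k))
      ≡⟨ sum-map-tabulate (λ x → x) (λ x → Listℕ.sum (List.map f (List.map (x ∷_) (words k m)))) ⟩
    ∑[ x < k ] Listℕ.sum (List.map f (List.map (x ∷_) (words k m)))
      ≡⟨ sum-cong-≗ {k} (λ x → trans (cong Listℕ.sum (sym (map-∘ (words k m)))) (sum-map-words m (λ w → f (x ∷ w)))) ⟩
    sumWords k (suc m) f ∎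

-- IsPerm for words of any length; the two agree definitionally when k = m.
IsInjection : ∀ {k m} → Vec (Fin k) m → Set
IsInjection {m = m} w = (i j : Fin m) → lookup w i ≡ lookup w j → i ≡ j

isInjection? : ∀ {k m} (w : Vec (Fin k) m) → Dec (IsInjection w)
isInjection? w = all? λ i → all? λ j → (lookup w i Finₚ.≟ lookup w j) →-dec (i Finₚ.≟ j)

_∉_ : ∀ {k m} → Fin k → Vec (Fin k) m → Set
x ∉ w = ∀ i → lookup w i ≢ x

_∉?_ : ∀ {k m} (x : Fin k) (w : Vec (Fin k) m) → Dec (x ∉ w)
x ∉? w = all? λ i → ¬? (lookup w i Finₚ.≟ x)

module _ {k m} (x : Fin k) (w : Vec (Fin k) m) where

  isInjection-∷⁻ : IsInjection (x ∷ w) → x ∉ w × IsInjection w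
  isInjection-∷⁻ inj = (λ i wᵢ≡x → Finₚ.0≢1+n (inj zero (suc i) (sym wᵢ≡x)))
                     , (λ i j wᵢ≡wⱼ → Finₚ.suc-injective (inj (suc i) (suc j) wᵢ≡wⱼ))

  isInjection-∷⁺ : x ∉ w × IsInjection w → IsInjection (x ∷ w)
  isInjection-∷⁺ _           zero    zero    _     = refl
  isInjection-∷⁺ (x∉w , _)   zero    (suc j) x≡wⱼ  = ⊥-elim (x∉w j (sym x≡wⱼ))
  isInjection-∷⁺ (x∉w , _)   (suc i) zero    wᵢ≡x  = ⊥-elim (x∉w i wᵢ≡x)
  isInjection-∷⁺ (_   , inj) (suc i) (suc j) wᵢ≡wⱼ = cong suc (inj i j wᵢ≡wⱼ)

module _ {n m} (x : Fin (suc n)) (σ : Vec (Fin n) m) where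

  isInjection-punchIn⁻ : IsInjection (map (punchIn x) σ) → IsInjection σ
  isInjection-punchIn⁻ inj i j σᵢ≡σⱼ = inj i j (begin
    lookup (map (punchIn x) σ) i  ≡⟨ lookup-map i (punchIn x) σ ⟩
    punchIn x (lookup σ i)        ≡⟨ cong (punchIn x) σᵢ≡σⱼ ⟩
    punchIn x (lookup σ j)        ≡⟨ lookup-map j (punchIn x) σ ⟨
    lookup (map (punchIn x) σ) j  ∎)

  isInjection-punchIn⁺ : IsInjection σ → IsInjection (map (punchIn x) σ)
  isInjection-punchIn⁺ inj i j eq = inj i j (punchIn-injective x _ _ (begin
    punchIn x (lookup σ i)        ≡⟨ lookup-map i (punchIn x) σ ⟨
    lookup (map (punchIn x) σ) i  ≡⟨ eq ⟩
    lookup (map (punchIn x) σ) j  ≡⟨ lookup-map j (punchIn x) σ ⟩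
    punchIn x (lookup σ j)        ∎))

sum-≢-punchIn : ∀ {n} (x : Fin (suc n)) (h : Fin (suc n) → ℕ) →
                ∑[ y < suc n ] (ind (¬? (y Finₚ.≟ x)) * h y) ≡ ∑[ z < n ] h (punchIn x z)
sum-≢-punchIn {n} x h = begin
  ∑[ y < suc n ] (ind (¬? (y Finₚ.≟ x)) * h y)
    ≡⟨ sum-remove {i = x} (λ y → ind (¬? (y Finₚ.≟ x)) * h y) ⟩
  ind (¬? (x Finₚ.≟ x)) * h x + ∑[ z < n ] (ind (¬? (punchIn x z Finₚ.≟ x)) * h (punchIn x z))
    ≡⟨ cong₂ _+_ (cong (_* h x) (ind-no (λ x≢x → x≢x refl) (¬? (x Finₚ.≟ x))))
                 (sum-cong-≗ {n} λ z → trans (cong (_* h (punchIn x z)) (ind-yes (punchInᵢ≢i x z) (¬? (punchIn x z Finₚ.≟ x))))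
                                             (*-identityˡ (h (punchIn x z)))) ⟩
  ∑[ z < n ] h (punchIn x z) ∎

sumWords-∉ : ∀ {n} m (x : Fin (suc n)) (g : Vec (Fin (suc n)) m → ℕ) →
             sumWords (suc n) m (λ w → ind (x ∉? w) * g w) ≡ sumWords n m (λ σ → g (map (punchIn x) σ))
sumWords-∉     zero    x g = +-identityʳ (g [])
sumWords-∉ {n} (suc m) x g = begin
  ∑[ y < suc n ] sumWords (suc n) m (λ w → ind (x ∉? (y ∷ w)) * g (y ∷ w))
    ≡⟨ sum-cong-≗ {suc n} (λ y → sumWords-cong {suc n} m (split y)) ⟩
  ∑[ y < suc n ] sumWords (suc n) m (λ w → ind (¬? (y Finₚ.≟ x)) * (ind (x ∉? w) * g (y ∷ w)))
    ≡⟨ sum-cong-≗ {suc n} (λ y → *-distribˡ-sumWords m (ind (¬? (y Finₚ.≟ x))) (λ w → ind (x ∉? w) * g (y ∷ w))) ⟨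
  ∑[ y < suc n ] (ind (¬? (y Finₚ.≟ x)) * sumWords (suc n) m (λ w → ind (x ∉? w) * g (y ∷ w)))
    ≡⟨ sum-≢-punchIn x (λ y → sumWords (suc n) m (λ w → ind (x ∉? w) * g (y ∷ w))) ⟩
  ∑[ z < n ] sumWords (suc n) m (λ w → ind (x ∉? w) * g (punchIn x z ∷ w))
    ≡⟨ sum-cong-≗ {n} (λ z → sumWords-∉ m x (λ w → g (punchIn x z ∷ w))) ⟩
  sumWords n (suc m) (λ σ → g (map (punchIn x) σ)) ∎
  where
  split : ∀ y w → ind (x ∉? (y ∷ w)) * g (y ∷ w) ≡ ind (¬? (y Finₚ.≟ x)) * (ind (x ∉? w) * g (y ∷ w))
  split y w = begin
    ind (x ∉? (y ∷ w)) * g (y ∷ w)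
      ≡⟨ cong (_* g (y ∷ w)) (ind-⇔ (λ x∉yw → x∉yw zero , x∉yw ∘ suc)
                                   (λ { (y≢x , _) zero → y≢x ; (_ , x∉w) (suc i) → x∉w i })
                                   (x ∉? (y ∷ w)) (¬? (y Finₚ.≟ x) ×-dec x ∉? w)) ⟩
    ind (¬? (y Finₚ.≟ x) ×-dec x ∉? w) * g (y ∷ w)
      ≡⟨ cong (_* g (y ∷ w)) (ind-× (¬? (y Finₚ.≟ x)) (x ∉? w)) ⟩
    (ind (¬? (y Finₚ.≟ x)) * ind (x ∉? w)) * g (y ∷ w)
      ≡⟨ *-assoc (ind (¬? (y Finₚ.≟ x))) _ _ ⟩
    ind (¬? (y Finₚ.≟ x)) * (ind (x ∉? w) * g (y ∷ w)) ∎

sumPerm : ∀ n → (Vec (Fin n) n → ℕ) → ℕ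
sumPerm n Q = sumWords n n (λ π → ind (isPerm? π) * Q π)

sumPerm-suc : ∀ n (Q : Vec (Fin (suc n)) (suc n) → ℕ) →
              sumPerm (suc n) Q ≡ ∑[ x < suc n ] sumPerm n (λ σ → Q (x ∷ map (punchIn x) σ))
sumPerm-suc n Q = sum-cong-≗ {suc n} λ x → begin
  sumWords (suc n) n (λ w → ind (isInjection? (x ∷ w)) * Q (x ∷ w))
    ≡⟨ sumWords-cong n (split x) ⟩
  sumWords (suc n) n (λ w → ind (x ∉? w) * (ind (isInjection? w) * Q (x ∷ w)))
    ≡⟨ sumWords-∉ n x _ ⟩
  sumWords n n (λ σ → ind (isInjection? (map (punchIn x) σ)) * Q (x ∷ map (punchIn x) σ))
    ≡⟨ sumWords-cong n (λ σ → cong (_* Q (x ∷ map (punchIn x) σ))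
         (ind-⇔ (isInjection-punchIn⁻ x σ) (isInjection-punchIn⁺ x σ) (isInjection? (map (punchIn x) σ)) (isPerm? σ))) ⟩
  sumPerm n (λ σ → Q (x ∷ map (punchIn x) σ)) ∎
  where
  split : ∀ x w → ind (isInjection? (x ∷ w)) * Q (x ∷ w) ≡ ind (x ∉? w) * (ind (isInjection? w) * Q (x ∷ w))
  split x w = begin
    ind (isInjection? (x ∷ w)) * Q (x ∷ w)
      ≡⟨ cong (_* Q (x ∷ w)) (ind-⇔ (isInjection-∷⁻ x w) (isInjection-∷⁺ x w)
                                    (isInjection? (x ∷ w)) (x ∉? w ×-dec isInjection? w)) ⟩
    ind (x ∉? w ×-dec isInjection? w) * Q (x ∷ w)
      ≡⟨ cong (_* Q (x ∷ w)) (ind-× (x ∉? w) (isInjection? w)) ⟩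
    (ind (x ∉? w) * ind (isInjection? w)) * Q (x ∷ w)
      ≡⟨ *-assoc (ind (x ∉? w)) _ _ ⟩
    ind (x ∉? w) * (ind (isInjection? w) * Q (x ∷ w)) ∎

module _ (n : ℕ) where

  sumPerm-cong : {P Q : Vec (Fin n) n → ℕ} → (∀ π → IsPerm π → P π ≡ Q π) → sumPerm n P ≡ sumPerm n Q
  sumPerm-cong {P} {Q} P≗Q = sumWords-cong n (λ π → on-perms π (isPerm? π))
    where
    on-perms : ∀ π (π? : Dec (IsPerm π)) → ind π? * P π ≡ ind π? * Q π
    on-perms π (yes π-perm) = cong (_+ 0) (P≗Q π π-perm)
    on-perms π (no _)       = refl

  sumPerm-distrib-+ : (P Q : Vec (Fin n) n → ℕ) → sumPerm n (λ π → P π + Q π) ≡ sumPerm n P + sumPerm n Q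
  sumPerm-distrib-+ P Q = trans (sumWords-cong n (λ π → *-distribˡ-+ (ind (isPerm? π)) (P π) (Q π))) (sumWords-distrib-+ n _ _)

  sumPerm-*ʳ : (P : Vec (Fin n) n → ℕ) (c : ℕ) → sumPerm n (λ π → P π * c) ≡ sumPerm n P * c
  sumPerm-*ʳ P c = begin
    sumWords n n (λ π → ind (isPerm? π) * (P π * c))
      ≡⟨ sumWords-cong n (λ π → trans (sym (*-assoc (ind (isPerm? π)) (P π) c)) (*-comm _ c)) ⟩
    sumWords n n (λ π → c * (ind (isPerm? π) * P π))
      ≡⟨ *-distribˡ-sumWords n c (λ π → ind (isPerm? π) * P π) ⟨
    c * sumPerm n P
      ≡⟨ *-comm c (sumPerm n P) ⟩
    sumPerm n P * c ∎

  sumPerm-zero : (P : Vec (Fin n) n → ℕ) → (∀ π → P π ≡ 0) → sumPerm n P ≡ 0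
  sumPerm-zero P P≗0 = sumWords-zero n _ (λ π → trans (cong (ind (isPerm? π) *_) (P≗0 π)) (*-zeroʳ (ind (isPerm? π))))

  sumPerm-sum≤ : ∀ v (P : Vec (Fin n) n → ℕ → ℕ) →
                 sumPerm n (λ π → sum≤ v (P π)) ≡ sum≤ v (λ s → sumPerm n (λ π → P π s))
  sumPerm-sum≤ zero    P = refl
  sumPerm-sum≤ (suc v) P = trans (sumPerm-distrib-+ _ _) (cong (_+ sumPerm n (λ π → P π (suc v))) (sumPerm-sum≤ v P))

Ends132′ : ∀ {k m} → Vec (Fin k) m → Fin m → Fin m → Set
Ends132′ w i j = i Fin.< j × ∃[ l ] (l Fin.< i × lookup w l Fin.< lookup w j × lookup w j Fin.< lookup w i)

ends132′? : ∀ {k m} (w : Vec (Fin k) m) (i j : Fin m) → Dec (Ends132′ w i j)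
ends132′? w i j =
  (i Fin.<? j) ×-dec any? λ l →
    (l Fin.<? i) ×-dec (lookup w l Fin.<? lookup w j) ×-dec (lookup w j Fin.<? lookup w i)

a3′ : ∀ {k m} → Vec (Fin k) m → ℕ
a3′ {m = m} w = ∑[ i < m ] ∑[ j < m ] ind (ends132′? w i j)

sum-map-pairs : ∀ n (h : Fin n × Fin n → ℕ) → Listℕ.sum (List.map h (pairs n)) ≡ ∑[ i < n ] ∑[ j < n ] h (i , j)
sum-map-pairs n h = begin
  Listℕ.sum (List.map h (pairs n))
    ≡⟨ sum-map-concatMap (λ i → List.map (i ,_) (allFin n)) h (allFin n) ⟩
  Listℕ.sum (List.map (λ i → Listℕ.sum (List.map h (List.map (i ,_) (allFin n)))) (allFin n))
    ≡⟨ sum-map-tabulate (λ i → i) (λ i → Listℕ.sum (List.map h (List.map (i ,_) (allFin n)))) ⟩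
  ∑[ i < n ] Listℕ.sum (List.map h (List.map (i ,_) (allFin n)))
    ≡⟨ sum-cong-≗ {n} (λ i → trans (cong Listℕ.sum (sym (map-∘ (allFin n))))
                                   (sum-map-tabulate (λ j → j) (λ j → h (i , j)))) ⟩
  ∑[ i < n ] ∑[ j < n ] h (i , j) ∎

a3≡a3′ : ∀ {n} (π : Vec (Fin n) n) → a3 π ≡ a3′ π
a3≡a3′ {n} π = trans (length-filter _ (pairs n)) (sum-map-pairs n _)

NewEnd132 : ∀ {k m} → Fin k → Vec (Fin k) m → Fin m → Fin m → Set
NewEnd132 x w i j = ¬ Ends132′ w i j × i Fin.< j × x Fin.< lookup w j × lookup w j Fin.< lookup w i

newEnd132? : ∀ {k m} (x : Fin k) (w : Vec (Fin k) m) (i j : Fin m) → Dec (NewEnd132 x w i j)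
newEnd132? x w i j = ¬? (ends132′? w i j) ×-dec (i Fin.<? j) ×-dec (x Fin.<? lookup w j) ×-dec (lookup w j Fin.<? lookup w i)

newEnds132 : ∀ {k m} → Fin k → Vec (Fin k) m → ℕ
newEnds132 {m = m} x w = ∑[ i < m ] ∑[ j < m ] ind (newEnd132? x w i j)

module _ {k m} (x : Fin k) (w : Vec (Fin k) m) where

  ends132-∷⁻ : ∀ {i j} → Ends132′ (x ∷ w) (suc i) (suc j) → Ends132′ w i j ⊎ NewEnd132 x w i j
  ends132-∷⁻ {i} {j} (s≤s i<j , l , l<i , wₗ<wⱼ , wⱼ<wᵢ) with ends132′? w i j | l
  ... | yes old | _      = inj₁ old
  ... | no ¬old | zero   = inj₂ (¬old , i<j , wₗ<wⱼ , wⱼ<wᵢ)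
  ... | no ¬old | suc l′ = ⊥-elim (¬old (i<j , l′ , ≤-pred l<i , wₗ<wⱼ , wⱼ<wᵢ))

  ends132-∷⁺ : ∀ {i j} → Ends132′ w i j ⊎ NewEnd132 x w i j → Ends132′ (x ∷ w) (suc i) (suc j)
  ends132-∷⁺ (inj₁ (i<j , l , l<i , wₗ<wⱼ , wⱼ<wᵢ)) = s≤s i<j , suc l , s≤s l<i , wₗ<wⱼ , wⱼ<wᵢ
  ends132-∷⁺ (inj₂ (_ , i<j , x<wⱼ , wⱼ<wᵢ))         = s≤s i<j , zero , s≤s z≤n , x<wⱼ , wⱼ<wᵢ

  a3′-∷ : a3′ (x ∷ w) ≡ a3′ w + newEnds132 x w
  a3′-∷ = begin
    ∑[ j < suc m ] ind (ends132′? (x ∷ w) zero j)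
      + ∑[ i < m ] (ind (ends132′? (x ∷ w) (suc i) zero) + ∑[ j < m ] ind (ends132′? (x ∷ w) (suc i) (suc j)))
      ≡⟨ cong₂ _+_ (sum-zero {suc m} _ (λ j → ind-no (λ { (_ , _ , () , _) }) (ends132′? (x ∷ w) zero j)))
                   (sum-cong-≗ {m} (λ i → cong₂ _+_ (ind-no (λ { (() , _) }) (ends132′? (x ∷ w) (suc i) zero))
                                                    (sum-cong-≗ {m} (λ j → split i j)))) ⟩
    ∑[ i < m ] ∑[ j < m ] (ind (ends132′? w i j) + ind (newEnd132? x w i j))
      ≡⟨ sum-cong-≗ {m} (λ i → ∑-distrib-+ (λ j → ind (ends132′? w i j)) (λ j → ind (newEnd132? x w i j))) ⟩
    ∑[ i < m ] (∑[ j < m ] ind (ends132′? w i j) + ∑[ j < m ] ind (newEnd132? x w i j))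
      ≡⟨ ∑-distrib-+ (λ i → ∑[ j < m ] ind (ends132′? w i j)) (λ i → ∑[ j < m ] ind (newEnd132? x w i j)) ⟩
    a3′ w + newEnds132 x w ∎
    where
    split : ∀ i j → ind (ends132′? (x ∷ w) (suc i) (suc j)) ≡ ind (ends132′? w i j) + ind (newEnd132? x w i j)
    split i j = ind-⊎ ends132-∷⁻ ends132-∷⁺ (λ old new → proj₁ new old)
                      (ends132′? (x ∷ w) (suc i) (suc j)) (ends132′? w i j) (newEnd132? x w i j)

module _ {k k′} (f : Fin k → Fin k′)
         (f-mono : ∀ {a b} → a Fin.< b → f a Fin.< f b)
         (f-cancel : ∀ {a b} → f a Fin.< f b → a Fin.< b) where

  a3′-map : ∀ {m} (w : Vec (Fin k) m) → a3′ (map f w) ≡ a3′ w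
  a3′-map {m} w = sum-cong-≗ {m} λ i → sum-cong-≗ {m} λ j → ind-⇔ to from (ends132′? (map f w) i j) (ends132′? w i j)
    where
    lookup-f : ∀ i → lookup (map f w) i ≡ f (lookup w i)
    lookup-f i = lookup-map i f w
    <⁻ : ∀ a b → lookup (map f w) a Fin.< lookup (map f w) b → lookup w a Fin.< lookup w b
    <⁻ a b = f-cancel ∘ subst₂ Fin._<_ (lookup-f a) (lookup-f b)
    <⁺ : ∀ a b → lookup w a Fin.< lookup w b → lookup (map f w) a Fin.< lookup (map f w) b
    <⁺ a b = subst₂ Fin._<_ (sym (lookup-f a)) (sym (lookup-f b)) ∘ f-mono
    to : ∀ {i j} → Ends132′ (map f w) i j → Ends132′ w i j
    to (i<j , l , l<i , lt₁ , lt₂) = i<j , l , l<i , <⁻ _ _ lt₁ , <⁻ _ _ lt₂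
    from : ∀ {i j} → Ends132′ w i j → Ends132′ (map f w) i j
    from (i<j , l , l<i , lt₁ , lt₂) = i<j , l , l<i , <⁺ _ _ lt₁ , <⁺ _ _ lt₂

punchIn-mono-< : ∀ {n} (x : Fin (suc n)) {a b : Fin n} → a Fin.< b → punchIn x a Fin.< punchIn x b
punchIn-mono-< x {a} {b} a<b =
  Finₚ.≤∧≢⇒< (Finₚ.punchIn-mono-≤ x a b (<⇒≤ a<b)) (λ eq → Finₚ.<⇒≢ a<b (punchIn-injective x a b eq))

punchIn-cancel-< : ∀ {n} (x : Fin (suc n)) {a b : Fin n} → punchIn x a Fin.< punchIn x b → a Fin.< b
punchIn-cancel-< x {a} {b} lt = ≰⇒> (λ b≤a → <⇒≱ lt (Finₚ.punchIn-mono-≤ x b a b≤a))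

a3′-punchIn : ∀ {n m} (x : Fin (suc n)) (σ : Vec (Fin n) m) → a3′ (map (punchIn x) σ) ≡ a3′ σ
a3′-punchIn x = a3′-map (punchIn x) (punchIn-mono-< x) (punchIn-cancel-< x)

a3-∷-punchIn : ∀ {n} (x : Fin (suc n)) (σ : Vec (Fin n) n) → a3 (x ∷ map (punchIn x) σ) ≡ a3 σ + newEnds132 x (map (punchIn x) σ)
a3-∷-punchIn x σ = begin
  a3 (x ∷ w)                  ≡⟨ a3≡a3′ (x ∷ w) ⟩
  a3′ (x ∷ w)                 ≡⟨ a3′-∷ x w ⟩
  a3′ w + newEnds132 x w      ≡⟨ cong (_+ newEnds132 x w) (a3′-punchIn x σ) ⟩
  a3′ σ + newEnds132 x w      ≡⟨ cong (_+ newEnds132 x w) (a3≡a3′ σ) ⟨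
  a3 σ + newEnds132 x w       ∎
  where w = map (punchIn x) σ

toℕ-punchIn-< : ∀ {n} (x : Fin (suc n)) (y : Fin n) → toℕ y < toℕ x → toℕ (punchIn x y) ≡ toℕ y
toℕ-punchIn-< (suc x) zero    _         = refl
toℕ-punchIn-< (suc x) (suc y) (s≤s y<x) = cong suc (toℕ-punchIn-< x y y<x)

toℕ-punchIn-≥ : ∀ {n} (x : Fin (suc n)) (y : Fin n) → toℕ x ≤ toℕ y → toℕ (punchIn x y) ≡ suc (toℕ y)
toℕ-punchIn-≥ zero    y       _         = refl
toℕ-punchIn-≥ (suc x) (suc y) (s≤s x≤y) = cong suc (toℕ-punchIn-≥ x y x≤y)

toℕ-≤-punchIn : ∀ {n} (x : Fin (suc n)) (y : Fin n) → toℕ y ≤ toℕ (punchIn x y)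
toℕ-≤-punchIn zero    y       = n≤1+n (toℕ y)
toℕ-≤-punchIn (suc x) zero    = z≤n
toℕ-≤-punchIn (suc x) (suc y) = s≤s (toℕ-≤-punchIn x y)

toℕ-punchIn-≤ : ∀ {n} (x : Fin (suc n)) (y : Fin n) → toℕ (punchIn x y) ≤ suc (toℕ y)
toℕ-punchIn-≤ zero    y       = ≤-refl
toℕ-punchIn-≤ (suc x) zero    = z≤n
toℕ-punchIn-≤ (suc x) (suc y) = s≤s (toℕ-punchIn-≤ x y)

isPerm⇒surjective : ∀ {n} (τ : Vec (Fin n) n) → IsPerm τ → ∀ y → ∃[ j ] lookup τ j ≡ y
isPerm⇒surjective {suc n} τ τ-perm y with any? (λ j → lookup τ j Finₚ.≟ y)
... | yes hit = hit
... | no miss with pigeonhole (n<1+n n) (λ j → punchOut {i = y} {j = lookup τ j} (λ y≡τⱼ → miss (j , sym y≡τⱼ)))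
...   | i , j , i<j , eq =
  ⊥-elim (Finₚ.<-irrefl (τ-perm i j (punchOut-injective (λ e → miss (i , sym e)) (λ e → miss (j , sym e)) eq)) i<j)

module FirstLetter {k} (τ : Vec (Fin (suc k)) (suc k)) (τ-perm : IsPerm τ) (x : Fin (suc (suc k))) where

  w : Vec (Fin (suc (suc k))) (suc k)
  w = map (punchIn x) τ

  X : ℕ
  X = toℕ x

  T V : Fin (suc k) → ℕ
  T j = toℕ (lookup τ j)
  V j = toℕ (lookup w j)

  V≡ : ∀ j → V j ≡ toℕ (punchIn x (lookup τ j))
  V≡ j = cong toℕ (lookup-map j (punchIn x) τ)

  V-below : ∀ {j} → T j < X → V j ≡ T j
  V-below {j} Tⱼ<X = trans (V≡ j) (toℕ-punchIn-< x _ Tⱼ<X)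

  V-above : ∀ {j} → X ≤ T j → V j ≡ suc (T j)
  V-above {j} X≤Tⱼ = trans (V≡ j) (toℕ-punchIn-≥ x _ X≤Tⱼ)

  T-injective : ∀ {i j} → T i ≡ T j → i ≡ j
  T-injective {i} {j} Tᵢ≡Tⱼ = τ-perm i j (toℕ-injective Tᵢ≡Tⱼ)

  V-injective : ∀ {i j} → V i ≡ V j → i ≡ j
  V-injective {i} {j} Vᵢ≡Vⱼ = isInjection-punchIn⁺ x τ τ-perm i j (toℕ-injective Vᵢ≡Vⱼ)

  T-onto : ∀ {c} → c < suc k → ∃[ j ] T j ≡ c
  T-onto c<1+k with isPerm⇒surjective τ τ-perm (fromℕ< c<1+k)
  ... | j , τⱼ≡c = j , trans (cong toℕ τⱼ≡c) (toℕ-fromℕ< c<1+k)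

  T₀<1+k : T zero < suc k
  T₀<1+k = toℕ<n (lookup τ zero)

  -- for i > 0, a letter w₀ < wⱼ would make (i , j) an old pair through l = 0
  newEnd-bounds : ∀ {i j} → NewEnd132 x w i j → X < V j × V j < V zero
  newEnd-bounds {zero}      (_ , _ , X<Vⱼ , Vⱼ<V₀) = X<Vⱼ , Vⱼ<V₀
  newEnd-bounds {suc i} {j} (¬old , i<j , X<Vⱼ , Vⱼ<Vᵢ) with <-cmp (V zero) (V j)
  ... | tri< V₀<Vⱼ _ _ = ⊥-elim (¬old (i<j , zero , s≤s z≤n , V₀<Vⱼ , Vⱼ<Vᵢ))
  ... | tri≈ _ V₀≡Vⱼ _ = ⊥-elim (<⇒≢ (≤-<-trans z≤n i<j) (cong toℕ (V-injective V₀≡Vⱼ)))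
  ... | tri> _ _ Vⱼ<V₀ = X<Vⱼ , Vⱼ<V₀

  newEnds-zero : T zero ≤ X → newEnds132 x w ≡ 0
  newEnds-zero T₀≤X = sum-zero {suc k} _ λ i → sum-zero {suc k} _ λ j → ind-no no-new (newEnd132? x w i j)
    where
    V₀≤1+X : V zero ≤ suc X
    V₀≤1+X = ≤-trans (subst (_≤ suc (T zero)) (sym (V≡ zero)) (toℕ-punchIn-≤ x _)) (s≤s T₀≤X)
    no-new : ∀ {i j} → ¬ NewEnd132 x w i j
    no-new new = let (X<Vⱼ , Vⱼ<V₀) = newEnd-bounds new in <⇒≱ X<Vⱼ (s≤s⁻¹ (<-≤-trans Vⱼ<V₀ V₀≤1+X))

  head-newEnd : X < T zero → ∀ {j} → X ≤ T j → T j < T zero → NewEnd132 x w zero j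
  head-newEnd X<T₀ {j} X≤Tⱼ Tⱼ<T₀ = (λ { (_ , _ , () , _) }) , 0<j , X<Vⱼ , Vⱼ<V₀
    where
    0<j : 0 < toℕ j
    0<j = n≢0⇒n>0 (λ j≡0 → <-irrefl (cong T (toℕ-injective {j = zero} j≡0)) Tⱼ<T₀)
    X<Vⱼ : X < V j
    X<Vⱼ = subst (X <_) (sym (V-above X≤Tⱼ)) (s≤s X≤Tⱼ)
    Vⱼ<V₀ : V j < V zero
    Vⱼ<V₀ = subst₂ _<_ (sym (V-above X≤Tⱼ)) (sym (V-above (<⇒≤ X<T₀))) (s≤s Tⱼ<T₀)

  one-newEnd : ∀ {i j} → NewEnd132 x w i j → 1 ≤ newEnds132 x w
  one-newEnd {i} {j} new =
    subst (_≤ newEnds132 x w) (ind-yes new (newEnd132? x w i j)) (≤-sum² (λ a b → ind (newEnd132? x w a b)) i j)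

  two-newEnds : ∀ {i j i′ j′} → NewEnd132 x w i j → NewEnd132 x w i′ j′ → (i , j) ≢ (i′ , j′) →
                2 ≤ newEnds132 x w
  two-newEnds {i} {j} {i′} {j′} new new′ ij≢i′j′ =
    subst (_≤ newEnds132 x w) (cong₂ _+_ (ind-yes new (newEnd132? x w i j)) (ind-yes new′ (newEnd132? x w i′ j′)))
          (+-≤-sum² (λ a b → ind (newEnd132? x w a b)) ij≢i′j′)

  newEnds-positive : X < T zero → 1 ≤ newEnds132 x w
  newEnds-positive X<T₀ with T-onto (<-trans X<T₀ T₀<1+k)
  ... | j , Tⱼ≡X = one-newEnd (head-newEnd X<T₀ (≤-reflexive (sym Tⱼ≡X)) (subst (_< T zero) (sym Tⱼ≡X) X<T₀))

  newEnds-far : suc X < T zero → 2 ≤ newEnds132 x w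
  newEnds-far 1+X<T₀ with T-onto (<-trans (<-trans (n<1+n X) 1+X<T₀) T₀<1+k) | T-onto (<-trans 1+X<T₀ T₀<1+k)
  ... | j , Tⱼ≡X | j′ , Tⱼ′≡1+X =
    two-newEnds new new′ (λ eq → 1+n≢n (trans (sym Tⱼ′≡1+X) (trans (cong (T ∘ proj₂) (sym eq)) Tⱼ≡X)))
    where
    X<T₀ = <-trans (n<1+n X) 1+X<T₀
    new  = head-newEnd X<T₀ (≤-reflexive (sym Tⱼ≡X)) (subst (_< T zero) (sym Tⱼ≡X) X<T₀)
    new′ = head-newEnd X<T₀ (≤-trans (n≤1+n X) (≤-reflexive (sym Tⱼ′≡1+X))) (subst (_< T zero) (sym Tⱼ′≡1+X) 1+X<T₀)

module SecondLetter {k} (τ : Vec (Fin (suc (suc k))) (suc (suc k))) (τ-perm : IsPerm τ) (x : Fin (suc (suc (suc k))))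
                    (T₀≡1+X : toℕ (lookup τ zero) ≡ suc (toℕ x)) where

  open FirstLetter τ τ-perm x

  X<T₀ : X < T zero
  X<T₀ = subst (X <_) (sym T₀≡1+X) (n<1+n X)

  V₀≡2+X : V zero ≡ suc (suc X)
  V₀≡2+X = trans (V-above (<⇒≤ X<T₀)) (cong suc T₀≡1+X)

  -- x + 1 stands in w where x stands in τ
  j₀ : Fin (suc (suc k))
  j₀ = proj₁ (T-onto (<-trans X<T₀ T₀<1+k))

  Tj₀≡X : T j₀ ≡ X
  Tj₀≡X = proj₂ (T-onto (<-trans X<T₀ T₀<1+k))

  Vj₀≡1+X : V j₀ ≡ suc X
  Vj₀≡1+X = trans (V-above (≤-reflexive (sym Tj₀≡X))) (cong suc Tj₀≡X)

  head-new : NewEnd132 x w zero j₀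
  head-new = head-newEnd X<T₀ (≤-reflexive (sym Tj₀≡X)) (subst (_< T zero) (sym Tj₀≡X) X<T₀)

  newEnds-ascent : T zero < T (suc zero) → 2 ≤ newEnds132 x w
  newEnds-ascent T₀<T₁ = two-newEnds head-new second-new (λ ())
    where
    X<T₁ : X < T (suc zero)
    X<T₁ = <-trans X<T₀ T₀<T₁
    1<j₀ : 1 < toℕ j₀
    1<j₀ = beyond-one j₀ (λ j₀≡0 → <-irrefl (trans (sym Tj₀≡X) (cong T j₀≡0)) X<T₀)
                         (λ j₀≡1 → <-irrefl (trans (sym Tj₀≡X) (cong T j₀≡1)) X<T₁)
      where
      beyond-one : (j : Fin (suc (suc k))) → j ≢ zero → j ≢ suc zero → 1 < toℕ j
      beyond-one zero          j≢0 _   = ⊥-elim (j≢0 refl)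
      beyond-one (suc zero)    _   j≢1 = ⊥-elim (j≢1 refl)
      beyond-one (suc (suc _)) _   _   = s≤s (s≤s z≤n)
    second-new : NewEnd132 x w (suc zero) j₀
    second-new = ¬old , 1<j₀ , subst (X <_) (sym Vj₀≡1+X) (n<1+n X)
               , subst₂ _<_ (sym Vj₀≡1+X) (sym (V-above (<⇒≤ X<T₁))) (s≤s X<T₁)
      where
      ¬old : ¬ Ends132′ w (suc zero) j₀
      ¬old (_ , zero , _ , V₀<Vj₀ , _) = <-asym V₀<Vj₀ (subst₂ _<_ (sym Vj₀≡1+X) (sym V₀≡2+X) (n<1+n (suc X)))
      ¬old (_ , suc _ , s≤s () , _)

  -- Only (0 , j₀) is new: the letter w₁ < x + 1 rules out (1 , j₀) and makes each (i , j₀), i > 1, old.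
  newEnds-descent : T (suc zero) < T zero → newEnds132 x w ≡ 1
  newEnds-descent T₁<T₀ = begin
    ∑[ i < suc (suc k) ] ∑[ j < suc (suc k) ] ind (newEnd132? x w i j)
      ≡⟨ sum-single (λ i → ∑[ j < suc (suc k) ] ind (newEnd132? x w i j)) zero
                    (λ i i≢0 → sum-zero {suc (suc k)} _ (λ j → ind-no (i≢0 ∘ new⇒head) (newEnd132? x w i j))) ⟩
    ∑[ j < suc (suc k) ] ind (newEnd132? x w zero j)
      ≡⟨ sum-single (λ j → ind (newEnd132? x w zero j)) j₀
                    (λ j j≢j₀ → ind-no (j≢j₀ ∘ new⇒j₀) (newEnd132? x w zero j)) ⟩
    ind (newEnd132? x w zero j₀)
      ≡⟨ ind-yes head-new (newEnd132? x w zero j₀) ⟩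
    1 ∎
    where
    new⇒j₀ : ∀ {i j} → NewEnd132 x w i j → j ≡ j₀
    new⇒j₀ {j = j} new with newEnd-bounds new
    ... | X<Vⱼ , Vⱼ<V₀ = V-injective (trans (≤-antisym (s≤s⁻¹ (subst (V j <_) V₀≡2+X Vⱼ<V₀)) X<Vⱼ) (sym Vj₀≡1+X))
    new⇒head : ∀ {i j} → NewEnd132 x w i j → i ≡ zero
    new⇒head {zero}  _   = refl
    new⇒head {suc i} new with new⇒j₀ new
    new⇒head {suc i} (¬old , i<j₀ , _ , Vj₀<Vᵢ) | refl = ⊥-elim (refute i i<j₀ Vj₀<Vᵢ ¬old)
      where
      T₁<X : T (suc zero) < X
      T₁<X = ≤∧≢⇒< (s≤s⁻¹ (subst (T (suc zero) <_) T₀≡1+X T₁<T₀)) T₁≢X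
        where
        T₁≢X : T (suc zero) ≢ X
        T₁≢X T₁≡X with subst (λ j → suc (toℕ i) < toℕ j) (sym (T-injective (trans T₁≡X (sym Tj₀≡X)))) i<j₀
        ... | s≤s ()
      V₁<Vj₀ : V (suc zero) < V j₀
      V₁<Vj₀ = subst₂ _<_ (sym (V-below T₁<X)) (sym Vj₀≡1+X) (<-trans T₁<X (n<1+n X))
      refute : ∀ i → suc (toℕ i) < toℕ j₀ → V j₀ < V (suc i) → ¬ Ends132′ w (suc i) j₀ → ⊥
      refute zero    _    Vj₀<V₁ _    = <-asym V₁<Vj₀ Vj₀<V₁
      refute (suc i) i<j₀ Vj₀<Vᵢ ¬old = ¬old (i<j₀ , suc zero , s≤s (s≤s z≤n) , V₁<Vj₀ , Vj₀<Vᵢ)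

-- junk value 0 on the empty word
headℕ : ∀ {k m} → Vec (Fin k) m → ℕ
headℕ []      = 0
headℕ (a ∷ _) = toℕ a

StartsWithDescent : ∀ {k m} → Vec (Fin k) m → Set
StartsWithDescent []          = ⊥
StartsWithDescent (_ ∷ [])    = ⊥
StartsWithDescent (a ∷ b ∷ _) = b Fin.< a

startsWithDescent? : ∀ {k m} (w : Vec (Fin k) m) → Dec (StartsWithDescent w)
startsWithDescent? []          = no λ ()
startsWithDescent? (_ ∷ [])    = no λ ()
startsWithDescent? (a ∷ b ∷ _) = b Fin.<? a

m+n≡1∧n>0⇒m≡0∧n≡1 : ∀ m {n} → m + n ≡ 1 → 1 ≤ n → m ≡ 0 × n ≡ 1
m+n≡1∧n>0⇒m≡0∧n≡1 zero    m+n≡1 _   = refl , m+n≡1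
m+n≡1∧n>0⇒m≡0∧n≡1 (suc m) m+n≡1 1≤n = ⊥-elim (n≮0 (subst (1 ≤_) (m+n≡0⇒n≡0 m (suc-injective m+n≡1)) 1≤n))

descent⇒newEnds≡1 : ∀ {k} (t : Fin (suc k)) (ρ : Vec (Fin (suc k)) k) (τ-perm : IsPerm (t ∷ ρ)) (x : Fin (suc (suc k))) →
                   StartsWithDescent (t ∷ ρ) → toℕ t ≡ suc (toℕ x) → newEnds132 x (map (punchIn x) (t ∷ ρ)) ≡ 1
descent⇒newEnds≡1 t (t₁ ∷ ρ) τ-perm x t₁<t t≡1+x = SecondLetter.newEnds-descent (t ∷ t₁ ∷ ρ) τ-perm x t≡1+x t₁<t

newEnds≡1⇒descent : ∀ {k} (t : Fin (suc k)) (ρ : Vec (Fin (suc k)) k) (τ-perm : IsPerm (t ∷ ρ)) (x : Fin (suc (suc k))) →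
             toℕ x < toℕ t → newEnds132 x (map (punchIn x) (t ∷ ρ)) ≡ 1 →
             StartsWithDescent (t ∷ ρ) × toℕ t ≡ suc (toℕ x)
newEnds≡1⇒descent zero []       _      x x<t _   = ⊥-elim (n≮0 x<t)
newEnds≡1⇒descent t    (t₁ ∷ ρ) τ-perm x x<t e≡1 with toℕ t ℕ.≟ suc (toℕ x)
... | no t≢1+x =
  ⊥-elim (1+n≰n (subst (2 ≤_) e≡1 (FirstLetter.newEnds-far (t ∷ t₁ ∷ ρ) τ-perm x (≤∧≢⇒< x<t (t≢1+x ∘ sym)))))
... | yes t≡1+x with Finₚ.<-cmp t₁ t
...   | tri< t₁<t _ _ = t₁<t , t≡1+x
...   | tri≈ _ t₁≡t _ = ⊥-elim (Finₚ.0≢1+n (τ-perm zero (suc zero) (sym t₁≡t)))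
...   | tri> _ _ t<t₁ =
  ⊥-elim (1+n≰n (subst (2 ≤_) e≡1 (SecondLetter.newEnds-ascent (t ∷ t₁ ∷ ρ) τ-perm x t≡1+x t<t₁)))

module Transfer {k} (t : Fin (suc k)) (ρ : Vec (Fin (suc k)) k) (τ-perm : IsPerm (t ∷ ρ)) (x : Fin (suc (suc k))) where

  open FirstLetter (t ∷ ρ) τ-perm x using (w; X; newEnds-zero; newEnds-positive)

  private
    τ = t ∷ ρ

    a3-split : a3 (x ∷ w) ≡ a3 τ + newEnds132 x w
    a3-split = a3-∷-punchIn x τ

  ind-a3≡0 : ind (a3 (x ∷ w) ℕ.≟ 0) ≡ ind (a3 τ ℕ.≟ 0) * ind (toℕ t ℕ.≤? X)
  ind-a3≡0 = begin
    ind (a3 (x ∷ w) ℕ.≟ 0)                          ≡⟨ ind-⇔ to from (a3 (x ∷ w) ℕ.≟ 0) (a3 τ ℕ.≟ 0 ×-dec toℕ t ℕ.≤? X) ⟩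
    ind (a3 τ ℕ.≟ 0 ×-dec toℕ t ℕ.≤? X)             ≡⟨ ind-× (a3 τ ℕ.≟ 0) (toℕ t ℕ.≤? X) ⟩
    ind (a3 τ ℕ.≟ 0) * ind (toℕ t ℕ.≤? X)           ∎
    where
    to : a3 (x ∷ w) ≡ 0 → a3 τ ≡ 0 × toℕ t ≤ X
    to a3π≡0 = m+n≡0⇒m≡0 (a3 τ) sum≡0
             , ≮⇒≥ (λ X<t → n≮0 (subst (1 ≤_) (m+n≡0⇒n≡0 (a3 τ) sum≡0) (newEnds-positive X<t)))
      where sum≡0 = trans (sym a3-split) a3π≡0
    from : a3 τ ≡ 0 × toℕ t ≤ X → a3 (x ∷ w) ≡ 0
    from (a3τ≡0 , t≤X) = trans a3-split (cong₂ _+_ a3τ≡0 (newEnds-zero t≤X))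

  ind-a3≡1 : ind (a3 (x ∷ w) ℕ.≟ 1) ≡ ind (a3 τ ℕ.≟ 1) * ind (toℕ t ℕ.≤? X)
                                       + (ind (a3 τ ℕ.≟ 0) * ind (startsWithDescent? τ)) * ind (toℕ t ℕ.≟ suc X)
  ind-a3≡1 = begin
    ind (a3 (x ∷ w) ℕ.≟ 1)
      ≡⟨ ind-⊎ to from disjoint (a3 (x ∷ w) ℕ.≟ 1) (a3τ≡1 ×-dec t≤X) ((a3τ≡0 ×-dec desc) ×-dec t≡1+X) ⟩
    ind (a3τ≡1 ×-dec t≤X) + ind ((a3τ≡0 ×-dec desc) ×-dec t≡1+X)
      ≡⟨ cong₂ _+_ (ind-× a3τ≡1 t≤X)
                   (trans (ind-× (a3τ≡0 ×-dec desc) t≡1+X) (cong (_* ind t≡1+X) (ind-× a3τ≡0 desc))) ⟩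
    ind a3τ≡1 * ind t≤X + (ind a3τ≡0 * ind desc) * ind t≡1+X ∎
    where
    a3τ≡1 = a3 τ ℕ.≟ 1
    a3τ≡0 = a3 τ ℕ.≟ 0
    t≤X   = toℕ t ℕ.≤? X
    t≡1+X = toℕ t ℕ.≟ suc X
    desc  = startsWithDescent? τ
    disjoint : a3 τ ≡ 1 × toℕ t ≤ X → ¬ ((a3 τ ≡ 0 × StartsWithDescent τ) × toℕ t ≡ suc X)
    disjoint (_ , t≤X) (_ , t≡1+X) = 1+n≰n (subst (_≤ X) t≡1+X t≤X)
    to : a3 (x ∷ w) ≡ 1 → (a3 τ ≡ 1 × toℕ t ≤ X) ⊎ ((a3 τ ≡ 0 × StartsWithDescent τ) × toℕ t ≡ suc X)
    to a3π≡1 with toℕ t ℕ.≤? X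
    ... | yes t≤X = inj₁ (trans (sym (+-identityʳ (a3 τ))) (trans (cong (a3 τ +_) (sym (newEnds-zero t≤X))) sum≡1) , t≤X)
      where sum≡1 = trans (sym a3-split) a3π≡1
    ... | no t≰X = inj₂ (one-new (m+n≡1∧n>0⇒m≡0∧n≡1 (a3 τ) sum≡1 (newEnds-positive (≰⇒> t≰X))))
      where
      sum≡1 = trans (sym a3-split) a3π≡1
      one-new : a3 τ ≡ 0 × newEnds132 x w ≡ 1 → (a3 τ ≡ 0 × StartsWithDescent τ) × toℕ t ≡ suc X
      one-new (a3τ≡0 , e≡1) =
        let (descent , t≡1+X) = newEnds≡1⇒descent t ρ τ-perm x (≰⇒> t≰X) e≡1 in (a3τ≡0 , descent) , t≡1+X
    from : (a3 τ ≡ 1 × toℕ t ≤ X) ⊎ ((a3 τ ≡ 0 × StartsWithDescent τ) × toℕ t ≡ suc X) → a3 (x ∷ w) ≡ 1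
    from (inj₁ (a3τ≡1 , t≤X)) = trans a3-split (cong₂ _+_ a3τ≡1 (newEnds-zero t≤X))
    from (inj₂ ((a3τ≡0 , descent) , t≡1+X)) =
      trans a3-split (cong₂ _+_ a3τ≡0 (descent⇒newEnds≡1 t ρ τ-perm x descent t≡1+X))

  ind-descent : ind (startsWithDescent? (x ∷ w)) ≡ ind (toℕ t ℕ.<? X)
  ind-descent = ind-⇔ (≤-<-trans (toℕ-≤-punchIn x t)) (λ t<X → subst (_< X) (sym (toℕ-punchIn-< x t t<X)) t<X)
                      (startsWithDescent? (x ∷ w)) (toℕ t ℕ.<? X)

-- Permutations of length n with first letter v (values are 0-based); a3 π ≡ 0 says that π avoids 132.
-- descAvoiders n v counts those avoiding 132 that start with v + 1 followed by a smaller letter.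
avoiders oneEnders descAvoiders : ℕ → ℕ → ℕ
avoiders     n v = sumPerm n λ π → ind (a3 π ℕ.≟ 0) * ind (headℕ π ℕ.≟ v)
oneEnders    n v = sumPerm n λ π → ind (a3 π ℕ.≟ 1) * ind (headℕ π ℕ.≟ v)
descAvoiders n v = sumPerm n λ π → (ind (a3 π ℕ.≟ 0) * ind (startsWithDescent? π)) * ind (headℕ π ℕ.≟ suc v)

sumPerm-byHead : ∀ n (Q : Vec (Fin (suc n)) (suc n) → ℕ) (R : ℕ → Vec (Fin n) n → ℕ) →
                 (∀ x σ → IsPerm σ → Q (x ∷ map (punchIn x) σ) ≡ R (toℕ x) σ) →
                 ∀ {v} → v < suc n → sumPerm (suc n) (λ π → Q π * ind (headℕ π ℕ.≟ v)) ≡ sumPerm n (R v)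
sumPerm-byHead n Q R Q≡R {v} v<1+n = begin
  sumPerm (suc n) (λ π → Q π * ind (headℕ π ℕ.≟ v))
    ≡⟨ sumPerm-suc n (λ π → Q π * ind (headℕ π ℕ.≟ v)) ⟩
  ∑[ x < suc n ] sumPerm n (λ σ → Q (x ∷ map (punchIn x) σ) * ind (toℕ x ℕ.≟ v))
    ≡⟨ sum-cong-≗ {suc n} (λ x → trans (sumPerm-cong n (λ σ σ-perm → cong (_* ind (toℕ x ℕ.≟ v)) (Q≡R x σ σ-perm)))
                                       (sumPerm-*ʳ n (R (toℕ x)) (ind (toℕ x ℕ.≟ v)))) ⟩
  ∑[ x < suc n ] (sumPerm n (R (toℕ x)) * ind (toℕ x ℕ.≟ v))
    ≡⟨ sum-select (λ u → sumPerm n (R u)) v<1+n ⟩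
  sumPerm n (R v) ∎

sumPerm-head-out : ∀ n (Q : Vec (Fin (suc n)) (suc n) → ℕ) {v} → n < v →
                   sumPerm (suc n) (λ π → Q π * ind (headℕ π ℕ.≟ v)) ≡ 0
sumPerm-head-out n Q {v} n<v = sumPerm-zero (suc n) (λ π → Q π * ind (headℕ π ℕ.≟ v)) λ where
  π@(t ∷ _) → trans (cong (Q π *_) (ind-no (λ t≡v → <-irrefl t≡v (<-≤-trans (toℕ<n t) n<v)) (toℕ t ℕ.≟ v)))
                    (*-zeroʳ (Q π))

sumPerm-head≤ : ∀ n (Q : Vec (Fin n) n → ℕ) v →
                sumPerm n (λ σ → Q σ * ind (headℕ σ ℕ.≤? v))
                  ≡ sum≤ v (λ s → sumPerm n (λ σ → Q σ * ind (headℕ σ ℕ.≟ s)))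
sumPerm-head≤ n Q v = begin
  sumPerm n (λ σ → Q σ * ind (headℕ σ ℕ.≤? v))
    ≡⟨ sumPerm-cong n (λ σ _ → cong (Q σ *_) (ind-≤-sum≤ (headℕ σ) v)) ⟩
  sumPerm n (λ σ → Q σ * sum≤ v (λ s → ind (headℕ σ ℕ.≟ s)))
    ≡⟨ sumPerm-cong n (λ σ _ → *-distribˡ-sum≤ v (Q σ) (λ s → ind (headℕ σ ℕ.≟ s))) ⟩
  sumPerm n (λ σ → sum≤ v (λ s → Q σ * ind (headℕ σ ℕ.≟ s)))
    ≡⟨ sumPerm-sum≤ n v (λ σ s → Q σ * ind (headℕ σ ℕ.≟ s)) ⟩
  sum≤ v (λ s → sumPerm n (λ σ → Q σ * ind (headℕ σ ℕ.≟ s))) ∎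

avoiders-step : ∀ p v → v ≤ suc p → avoiders (suc (suc p)) v ≡ sum≤ v (avoiders (suc p))
avoiders-step p v v≤1+p = begin
  avoiders (suc (suc p)) v
    ≡⟨ sumPerm-byHead (suc p) (λ π → ind (a3 π ℕ.≟ 0)) (λ u σ → ind (a3 σ ℕ.≟ 0) * ind (headℕ σ ℕ.≤? u))
                      (λ { x (t ∷ ρ) σ-perm → Transfer.ind-a3≡0 t ρ σ-perm x }) (s≤s v≤1+p) ⟩
  sumPerm (suc p) (λ σ → ind (a3 σ ℕ.≟ 0) * ind (headℕ σ ℕ.≤? v))
    ≡⟨ sumPerm-head≤ (suc p) (λ σ → ind (a3 σ ℕ.≟ 0)) v ⟩
  sum≤ v (avoiders (suc p)) ∎

oneEnders-step : ∀ p v → v ≤ suc p → oneEnders (suc (suc p)) v ≡ sum≤ v (oneEnders (suc p)) + descAvoiders (suc p) v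
oneEnders-step p v v≤1+p = begin
  oneEnders (suc (suc p)) v
    ≡⟨ sumPerm-byHead (suc p) (λ π → ind (a3 π ℕ.≟ 1)) (λ u σ → One σ u + Desc σ u)
                      (λ { x (t ∷ ρ) σ-perm → Transfer.ind-a3≡1 t ρ σ-perm x }) (s≤s v≤1+p) ⟩
  sumPerm (suc p) (λ σ → One σ v + Desc σ v)
    ≡⟨ sumPerm-distrib-+ (suc p) (λ σ → One σ v) (λ σ → Desc σ v) ⟩
  sumPerm (suc p) (λ σ → One σ v) + descAvoiders (suc p) v
    ≡⟨ cong (_+ descAvoiders (suc p) v) (sumPerm-head≤ (suc p) (λ σ → ind (a3 σ ℕ.≟ 1)) v) ⟩
  sum≤ v (oneEnders (suc p)) + descAvoiders (suc p) v ∎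
  where
  One Desc : Vec (Fin (suc p)) (suc p) → ℕ → ℕ
  One  σ u = ind (a3 σ ℕ.≟ 1) * ind (headℕ σ ℕ.≤? u)
  Desc σ u = (ind (a3 σ ℕ.≟ 0) * ind (startsWithDescent? σ)) * ind (headℕ σ ℕ.≟ suc u)

descAvoiders-step : ∀ p v → v ≤ p → descAvoiders (suc (suc p)) v ≡ sum≤ v (avoiders (suc p))
descAvoiders-step p v v≤p = begin
  descAvoiders (suc (suc p)) v
    ≡⟨ sumPerm-byHead (suc p) (λ π → ind (a3 π ℕ.≟ 0) * ind (startsWithDescent? π))
                      (λ u σ → ind (a3 σ ℕ.≟ 0) * ind (headℕ σ ℕ.<? u)) transfer (s≤s (s≤s v≤p)) ⟩
  sumPerm (suc p) (λ σ → ind (a3 σ ℕ.≟ 0) * ind (headℕ σ ℕ.<? suc v))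
    ≡⟨ sumPerm-cong (suc p) (λ σ _ → cong (ind (a3 σ ℕ.≟ 0) *_)
                                          (ind-⇔ s≤s⁻¹ s≤s (headℕ σ ℕ.<? suc v) (headℕ σ ℕ.≤? v))) ⟩
  sumPerm (suc p) (λ σ → ind (a3 σ ℕ.≟ 0) * ind (headℕ σ ℕ.≤? v))
    ≡⟨ sumPerm-head≤ (suc p) (λ σ → ind (a3 σ ℕ.≟ 0)) v ⟩
  sum≤ v (avoiders (suc p)) ∎
  where
  transfer : ∀ x σ → IsPerm σ →
             ind (a3 (x ∷ map (punchIn x) σ) ℕ.≟ 0) * ind (startsWithDescent? (x ∷ map (punchIn x) σ))
               ≡ ind (a3 σ ℕ.≟ 0) * ind (headℕ σ ℕ.<? toℕ x)
  transfer x σ@(t ∷ ρ) σ-perm = begin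
    ind (a3 (x ∷ map (punchIn x) σ) ℕ.≟ 0) * ind (startsWithDescent? (x ∷ map (punchIn x) σ))
      ≡⟨ cong₂ _*_ (Transfer.ind-a3≡0 t ρ σ-perm x) (Transfer.ind-descent t ρ σ-perm x) ⟩
    (ind (a3 σ ℕ.≟ 0) * ind t≤x) * ind t<x
      ≡⟨ *-assoc (ind (a3 σ ℕ.≟ 0)) (ind t≤x) (ind t<x) ⟩
    ind (a3 σ ℕ.≟ 0) * (ind t≤x * ind t<x)
      ≡⟨ cong (ind (a3 σ ℕ.≟ 0) *_) (ind-× t≤x t<x) ⟨
    ind (a3 σ ℕ.≟ 0) * ind (t≤x ×-dec t<x)
      ≡⟨ cong (ind (a3 σ ℕ.≟ 0) *_) (ind-⇔ proj₂ (λ t<x → <⇒≤ t<x , t<x) (t≤x ×-dec t<x) t<x) ⟩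
    ind (a3 σ ℕ.≟ 0) * ind t<x ∎
    where
    t≤x = toℕ t ℕ.≤? toℕ x
    t<x = toℕ t ℕ.<? toℕ x

avoiders-out : ∀ p v → p < v → avoiders (suc p) v ≡ 0
avoiders-out p v = sumPerm-head-out p (λ π → ind (a3 π ℕ.≟ 0))

oneEnders-out : ∀ p v → p < v → oneEnders (suc p) v ≡ 0
oneEnders-out p v = sumPerm-head-out p (λ π → ind (a3 π ℕ.≟ 1))

descAvoiders-out : ∀ p v → p < v → descAvoiders (suc (suc p)) v ≡ 0
descAvoiders-out p v p<v =
  sumPerm-head-out (suc p) (λ π → ind (a3 π ℕ.≟ 0) * ind (startsWithDescent? π)) (s≤s p<v)

avoiders-base : avoiders 1 0 ≡ 1
avoiders-base = refl

oneEnders-base : ∀ v → oneEnders 1 v ≡ 0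
oneEnders-base v = refl

descAvoiders-base : ∀ v → descAvoiders 1 v ≡ 0
descAvoiders-base v = refl

countA3one≡sum-oneEnders : ∀ p → countA3one (suc p) ≡ sum≤ p (oneEnders (suc p))
countA3one≡sum-oneEnders p = begin
  countA3one n
    ≡⟨ length-filter (λ π → isPerm? π ×-dec (a3 π ℕ.≟ 1)) (words n n) ⟩
  Listℕ.sum (List.map (λ π → ind (isPerm? π ×-dec (a3 π ℕ.≟ 1))) (words n n))
    ≡⟨ sum-map-words n (λ π → ind (isPerm? π ×-dec (a3 π ℕ.≟ 1))) ⟩
  sumWords n n (λ π → ind (isPerm? π ×-dec (a3 π ℕ.≟ 1)))
    ≡⟨ sumWords-cong n (λ π → ind-× (isPerm? π) (a3 π ℕ.≟ 1)) ⟩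
  sumPerm n (λ π → ind (a3 π ℕ.≟ 1))
    ≡⟨ sumPerm-cong n head-in-range ⟩
  sumPerm n (λ π → ind (a3 π ℕ.≟ 1) * ind (headℕ π ℕ.≤? p))
    ≡⟨ sumPerm-head≤ n (λ π → ind (a3 π ℕ.≟ 1)) p ⟩
  sum≤ p (oneEnders n) ∎
  where
  n = suc p
  head-in-range : ∀ π → IsPerm π → ind (a3 π ℕ.≟ 1) ≡ ind (a3 π ℕ.≟ 1) * ind (headℕ π ℕ.≤? p)
  head-in-range π@(t ∷ _) _ =
    sym (trans (cong (ind (a3 π ℕ.≟ 1) *_) (ind-yes (s≤s⁻¹ (toℕ<n t)) (toℕ t ℕ.≤? p))) (*-identityʳ _))

binom-shift≡binomA : ∀ p → binom-shift 3 (suc (p + p)) (suc p) ≡ binomA (suc p)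
binom-shift≡binomA zero          = refl
binom-shift≡binomA (suc zero)    = refl
binom-shift≡binomA (suc (suc m)) = trans (binom≡C _ m) (cong (_C m) (sym 2[m+3]∸1≡1+p+p))
  where
  p = suc (suc m)
  2[m+3]∸1≡1+p+p : 2 * (m + 3) ∸ 1 ≡ suc (p + p)
  2[m+3]∸1≡1+p+p = begin
    2 * (m + 3) ∸ 1   ≡⟨ cong (λ n → 2 * n ∸ 1) (+-comm m 3) ⟩
    2 * suc p ∸ 1     ≡⟨ cong (_∸ 1) (*-suc 2 p) ⟩
    suc (2 * p)       ≡⟨ cong (λ n → suc (p + n)) (+-identityʳ p) ⟩
    suc (p + p)       ∎

proposition9 : (n : ℕ) → 1 ≤ n → countA3one n ≡ binomA n
proposition9 (suc p) _ = begin
  countA3one (suc p)                   ≡⟨ countA3one≡sum-oneEnders p ⟩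
  sum≤ p (oneEnders (suc p))           ≡⟨ Counts.sum-b p ⟩
  binom-shift 3 (suc (p + p)) (suc p)  ≡⟨ binom-shift≡binomA p ⟩
  binomA (suc p)                       ∎
  where
  module Counts = Recurrences avoiders oneEnders descAvoiders
    avoiders-base avoiders-out avoiders-step
    oneEnders-base oneEnders-out oneEnders-step
    descAvoiders-base descAvoiders-step descAvoiders-out
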